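{- Let $k\ge 1$, $d\ge k$, $\nu>d$ be integers and $(Y,X)$ a feasible base of $LP_{\nu,d,k}$. If $(Y,X)$ is optimal, then $d\in X$ and $0\in Y\cup X$.
   Context: Binomial coefficients $\binom{n}{m}$ are $0$ when $m<0$ or $m>n$. $LP_{\nu,d,k}$ is the linear program in real variables $y_0,\ldots,y_{\nu-1},x_0,\ldots,x_d\ge 0$: minimize $\sum_{i=0}^{\nu-1}\binom{\nu}{i}y_i+\sum_{i=0}^d\binom{\nu}{i}x_i$ subject to $(c_k)$: $\sum_{i=k}^d\binom{\nu-k}{i-k}x_i-\sum_{i=k}^{\nu-1}\binom{\nu-k}{i-k}y_i=1$, and $(c_h)$ for $h\in\{0,\ldots,k-1\}$: $\sum_{i=h}^d\binom{\nu-k}{i-h}x_i-\sum_{i=h}^{\nu-k+h}\binom{\nu-k}{i-h}y_i=0$. A pair $(Y,X)$ with $Y\subseteq\{0,\ldots,\nu-1\}$, $X\subseteq\{0,\ldots,d\}$ is a base if the variables $\{y_i:i\in Y\}\cup\{x_i:i\in X\}$ form a linear-programming basis (their constraint-matrix columns form a basis of $\mathbb{R}^{k+1}$); its basic solution is the unique solution of the equality constraints with all other variables $0$. The base is feasible if its basic solution has all coordinates non-negative, and optimal if, moreover, its basic solution is an optimal solution of $LP_{\nu,d,k}$. -}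

module Defs where

open import Data.Nat using (ℕ; zero; suc; _∸_; _≡ᵇ_)
open import Data.Nat.Combinatorics using (_C_)
open import Data.Integer using (ℤ; +_; -[1+_]) renaming (_-_ to _-ℤ_)
open import Data.Fin using (Fin; toℕ)
open import Data.Fin.Subset using (Subset; _∈_; _∉_)
open import Data.Rational using (ℚ; 0ℚ; 1ℚ; _+_; _-_; _*_; _≤_; _/_)
open import Data.Bool using (if_then_else_)
open import Data.Product using (_×_; Σ; _,_)
open import Relation.Binary.PropositionalEquality using (_≡_)

ℕ→ℚ : ℕ → ℚ
ℕ→ℚ n = + n / 1

-- Binomial coefficient with integer lower index: binom n m = 0 if m < 0 or m > n
-- (the latter is already the behaviour of the library's _C_).
binom : ℕ → ℤ → ℕ
binom n (+ m)    = n C m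
binom n -[1+ _ ] = 0

Σℚ : ∀ {n} → (Fin n → ℚ) → ℚ
Σℚ {zero}  f = 0ℚ
Σℚ {suc n} f = f Fin.zero + Σℚ (λ i → f (Fin.suc i))

-- Since all y-indices are ≤ ν-1,
-- all x-indices are ≤ d, and binom vanishes for i < h and for i - h > ν - k,
-- summing over all variables gives exactly the ranges of the paper:
-- (c_h): Σ_{i=h}^{d} C(ν-k,i-h) x_i - Σ_{i=h}^{ν-k+h} C(ν-k,i-h) y_i
-- (c_k): Σ_{i=k}^{d} C(ν-k,i-k) x_i - Σ_{i=k}^{ν-1} C(ν-k,i-k) y_i
lhs : (ν d k : ℕ) → (Fin ν → ℚ) → (Fin (suc d) → ℚ) → Fin (suc k) → ℚ
lhs ν d k y x h =
  Σℚ (λ i → ℕ→ℚ (binom (ν ∸ k) (+ toℕ i -ℤ + toℕ h)) * x i)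
  - Σℚ (λ i → ℕ→ℚ (binom (ν ∸ k) (+ toℕ i -ℤ + toℕ h)) * y i)

rhs : (k : ℕ) → Fin (suc k) → ℚ
rhs k h = if toℕ h ≡ᵇ k then 1ℚ else 0ℚ

SatisfiesConstraints : (ν d k : ℕ) → (Fin ν → ℚ) → (Fin (suc d) → ℚ) → Set
SatisfiesConstraints ν d k y x = ∀ h → lhs ν d k y x h ≡ rhs k h

NonNeg : (ν d : ℕ) → (Fin ν → ℚ) → (Fin (suc d) → ℚ) → Set
NonNeg ν d y x = (∀ i → 0ℚ ≤ y i) × (∀ i → 0ℚ ≤ x i)

Feasible : (ν d k : ℕ) → (Fin ν → ℚ) → (Fin (suc d) → ℚ) → Set
Feasible ν d k y x = NonNeg ν d y x × SatisfiesConstraints ν d k y x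

objective : (ν d : ℕ) → (Fin ν → ℚ) → (Fin (suc d) → ℚ) → ℚ
objective ν d y x =
  Σℚ (λ i → ℕ→ℚ (ν C toℕ i) * y i) + Σℚ (λ i → ℕ→ℚ (ν C toℕ i) * x i)

SupportedOn : ∀ {ν d} → Subset ν → Subset (suc d) → (Fin ν → ℚ) → (Fin (suc d) → ℚ) → Set
SupportedOn Y X y x = (∀ i → i ∉ Y → y i ≡ 0ℚ) × (∀ i → i ∉ X → x i ≡ 0ℚ)

-- (Y,X) is a base: the columns {y_i : i ∈ Y} ∪ {x_i : i ∈ X} of the constraint
-- matrix form a basis of ℚ^{k+1}, i.e. every vector b is a linear combination of
-- them with uniquely determined coefficients.
IsBase : (ν d k : ℕ) → Subset ν → Subset (suc d) → Set
IsBase ν d k Y X =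
  ∀ (b : Fin (suc k) → ℚ) →
    Σ (Fin ν → ℚ) (λ y → Σ (Fin (suc d) → ℚ) (λ x →
        SupportedOn Y X y x × (∀ h → lhs ν d k y x h ≡ b h)))
    × (∀ y x y' x' →
         SupportedOn Y X y x → (∀ h → lhs ν d k y x h ≡ b h) →
         SupportedOn Y X y' x' → (∀ h → lhs ν d k y' x' h ≡ b h) →
         (∀ i → y i ≡ y' i) × (∀ i → x i ≡ x' i))

IsBasicSolution : (ν d k : ℕ) → Subset ν → Subset (suc d) →
                  (Fin ν → ℚ) → (Fin (suc d) → ℚ) → Set
IsBasicSolution ν d k Y X y x = SupportedOn Y X y x × SatisfiesConstraints ν d k y x

IsOptimalSolution : (ν d k : ℕ) → (Fin ν → ℚ) → (Fin (suc d) → ℚ) → Set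
IsOptimalSolution ν d k y x =
  Feasible ν d k y x ×
  (∀ y' x' → Feasible ν d k y' x' → objective ν d y x ≤ objective ν d y' x')

module Submission where

-- Put z = x - y (padded with zeros) and u i = C(ν, i) · z i. By C(ν, i) C(i, j) = C(ν, j) C(ν - j, i - j) and
-- Vandermonde's identity, the constraints say exactly that Σ_{i<ν} u i · p i = p ν for every polynomial p of
-- degree ≤ k. A feasible point costs at least Σ |u i|, and every such u vanishing above d is attained, at
-- cost Σ |u i|, by splitting it into positive and negative parts.
-- For a basic solution u has exactly k + 1 nonzero entries: with fewer, the polynomial vanishing on them
-- would contradict p ν > 0; with more, interpolating one of them by the others gives a kernel direction
-- contradicting uniqueness. So u is the vector of Lagrange weights extrapolating from these nodes to ν.
-- The weight of the greatest node a is positive, whence x a > 0 and a ≤ d. If x d = 0, trading a for d,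
-- and if x 0 = y 0 = 0, trading the least node for 0, multiplies every other weight by a factor ≤ 1 and
-- strictly shrinks the moved one; the cost drops, contradicting optimality.

module Rationals where

  open import Data.Nat as ℕ using (z≤n; s≤s)
  import Data.Nat.Properties as ℕP
  open import Data.Integer as ℤ using (+_)
  import Data.Integer.Properties as ℤP
  open import Data.Nat.Coprimality using (1-coprimeTo) renaming (sym to coprime-sym)
  open import Data.Rational
    using (ℚ; mkℚ; 0ℚ; 1ℚ; ½; _+_; _*_; _-_; -_; _≤_; _<_; _/_; ∣_∣; *≤*; *<*; 1/_; positive; nonNegative; ≢-nonZero)
  open import Data.Rational.Properties
  open import Data.Rational.Solver using (module +-*-Solver)
  open import Data.Sum using (inj₁; inj₂)
  open import Relation.Binary.PropositionalEquality
  open import Relation.Binary using (tri<; tri≈; tri>)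
  open import Relation.Nullary using (Dec; yes; no)
  open import Relation.Nullary.Decidable using (⌊_⌋)
  open import Data.Bool using (Bool; false; not)
  open import Data.Empty using (⊥-elim)
  open import Defs using (ℕ→ℚ)
  open +-*-Solver

  private
    ℕ→ℚ≡mkℚ : ∀ n → ℕ→ℚ n ≡ mkℚ (+ n) 0 (coprime-sym (1-coprimeTo n))
    ℕ→ℚ≡mkℚ n = ↥p/↧p≡p (mkℚ (+ n) 0 (coprime-sym (1-coprimeTo n)))

  ℕ→ℚ-+ : ∀ m n → ℕ→ℚ (m ℕ.+ n) ≡ ℕ→ℚ m + ℕ→ℚ n
  ℕ→ℚ-+ m n rewrite ℕ→ℚ≡mkℚ m | ℕ→ℚ≡mkℚ n =
    cong (_/ 1) (sym (trans (cong₂ ℤ._+_ (ℤP.*-identityʳ (+ m)) (ℤP.*-identityʳ (+ n))) (sym (ℤP.pos-+ m n))))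

  ℕ→ℚ-* : ∀ m n → ℕ→ℚ (m ℕ.* n) ≡ ℕ→ℚ m * ℕ→ℚ n
  ℕ→ℚ-* m n rewrite ℕ→ℚ≡mkℚ m | ℕ→ℚ≡mkℚ n = cong (_/ 1) (ℤP.pos-* m n)

  ℕ→ℚ-∸ : ∀ m n → n ℕ.≤ m → ℕ→ℚ (m ℕ.∸ n) ≡ ℕ→ℚ m - ℕ→ℚ n
  ℕ→ℚ-∸ m n n≤m = begin
    ℕ→ℚ (m ℕ.∸ n)                     ≡⟨ solve 2 (λ a b → a := (a :+ b) :- b) refl (ℕ→ℚ (m ℕ.∸ n)) (ℕ→ℚ n) ⟩
    (ℕ→ℚ (m ℕ.∸ n) + ℕ→ℚ n) - ℕ→ℚ n  ≡⟨ cong (_- ℕ→ℚ n) (sym (ℕ→ℚ-+ (m ℕ.∸ n) n)) ⟩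
    ℕ→ℚ (m ℕ.∸ n ℕ.+ n) - ℕ→ℚ n       ≡⟨ cong (λ w → ℕ→ℚ w - ℕ→ℚ n) (ℕP.m∸n+n≡m n≤m) ⟩
    ℕ→ℚ m - ℕ→ℚ n                     ∎
    where open ≡-Reasoning

  ℕ→ℚ-mono-< : ∀ {m n} → m ℕ.< n → ℕ→ℚ m < ℕ→ℚ n
  ℕ→ℚ-mono-< {m} {n} m<n rewrite ℕ→ℚ≡mkℚ m | ℕ→ℚ≡mkℚ n =
    *<* (subst₂ ℤ._<_ (sym (ℤP.*-identityʳ (+ m))) (sym (ℤP.*-identityʳ (+ n))) (ℤ.+<+ m<n))

  ℕ→ℚ-mono-≤ : ∀ {m n} → m ℕ.≤ n → ℕ→ℚ m ≤ ℕ→ℚ n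
  ℕ→ℚ-mono-≤ {m} {n} m≤n rewrite ℕ→ℚ≡mkℚ m | ℕ→ℚ≡mkℚ n =
    *≤* (subst₂ ℤ._≤_ (sym (ℤP.*-identityʳ (+ m))) (sym (ℤP.*-identityʳ (+ n))) (ℤ.+≤+ m≤n))

  ℕ→ℚ-injective : ∀ {m n} → ℕ→ℚ m ≡ ℕ→ℚ n → m ≡ n
  ℕ→ℚ-injective {m} {n} eq with ℕP.<-cmp m n
  ... | tri< m<n _ _ = ⊥-elim (<-irrefl eq (ℕ→ℚ-mono-< m<n))
  ... | tri≈ _ m≡n _ = m≡n
  ... | tri> _ _ n<m = ⊥-elim (<-irrefl (sym eq) (ℕ→ℚ-mono-< n<m))

  ℕ→ℚ-≢0 : ∀ {n} → 0 ℕ.< n → ℕ→ℚ n ≢ 0ℚ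
  ℕ→ℚ-≢0 0<n eq = <-irrefl (sym eq) (ℕ→ℚ-mono-< 0<n)

  private
    ∣ℕ→ℚ-ℕ→ℚ∣-≥ : ∀ {m n} → n ℕ.≤ m → ∣ ℕ→ℚ m - ℕ→ℚ n ∣ ≡ ℕ→ℚ ℕ.∣ m - n ∣
    ∣ℕ→ℚ-ℕ→ℚ∣-≥ {m} {n} n≤m = begin
      ∣ ℕ→ℚ m - ℕ→ℚ n ∣  ≡⟨ cong ∣_∣ (sym (ℕ→ℚ-∸ m n n≤m)) ⟩
      ∣ ℕ→ℚ (m ℕ.∸ n) ∣  ≡⟨ 0≤p⇒∣p∣≡p (ℕ→ℚ-mono-≤ {0} {m ℕ.∸ n} z≤n) ⟩
      ℕ→ℚ (m ℕ.∸ n)      ≡⟨ cong ℕ→ℚ (sym (ℕP.m≤n⇒∣n-m∣≡n∸m n≤m)) ⟩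
      ℕ→ℚ ℕ.∣ m - n ∣    ∎
      where open ≡-Reasoning

  ∣ℕ→ℚ-ℕ→ℚ∣ : ∀ m n → ∣ ℕ→ℚ m - ℕ→ℚ n ∣ ≡ ℕ→ℚ ℕ.∣ m - n ∣
  ∣ℕ→ℚ-ℕ→ℚ∣ m n with ℕP.≤-total n m
  ... | inj₁ n≤m = ∣ℕ→ℚ-ℕ→ℚ∣-≥ n≤m
  ... | inj₂ m≤n = begin
    ∣ ℕ→ℚ m - ℕ→ℚ n ∣     ≡⟨ cong ∣_∣ (solve 2 (λ a b → a :- b := :- (b :- a)) refl (ℕ→ℚ m) (ℕ→ℚ n)) ⟩
    ∣ - (ℕ→ℚ n - ℕ→ℚ m) ∣ ≡⟨ ∣-p∣≡∣p∣ (ℕ→ℚ n - ℕ→ℚ m) ⟩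
    ∣ ℕ→ℚ n - ℕ→ℚ m ∣     ≡⟨ ∣ℕ→ℚ-ℕ→ℚ∣-≥ m≤n ⟩
    ℕ→ℚ ℕ.∣ n - m ∣       ≡⟨ cong ℕ→ℚ (ℕP.∣-∣-comm n m) ⟩
    ℕ→ℚ ℕ.∣ m - n ∣       ∎
    where open ≡-Reasoning

  ℕ→ℚ-ℕ→ℚ≢0 : ∀ {m n} → m ≢ n → ℕ→ℚ m - ℕ→ℚ n ≢ 0ℚ
  ℕ→ℚ-ℕ→ℚ≢0 {m} {n} m≢n eq = m≢n (ℕ→ℚ-injective (begin
    ℕ→ℚ m                        ≡⟨ solve 2 (λ a b → a := (a :- b) :+ b) refl (ℕ→ℚ m) (ℕ→ℚ n) ⟩
    (ℕ→ℚ m - ℕ→ℚ n) + ℕ→ℚ n      ≡⟨ cong (_+ ℕ→ℚ n) eq ⟩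
    0ℚ + ℕ→ℚ n                   ≡⟨ +-identityˡ (ℕ→ℚ n) ⟩
    ℕ→ℚ n                        ∎))
    where open ≡-Reasoning

  -- A total inverse, junk value inv 0ℚ = 0ℚ; it spares threading NonZero instances through sums.
  inv : ℚ → ℚ
  inv p with p ≟ 0ℚ
  ... | yes _ = 0ℚ
  ... | no p≢0 = 1/_ p {{≢-nonZero p≢0}}

  *-invʳ : ∀ p → p ≢ 0ℚ → p * inv p ≡ 1ℚ
  *-invʳ p p≢0 with p ≟ 0ℚ
  ... | yes p≡0 = ⊥-elim (p≢0 p≡0)
  ... | no p≢0′ = *-inverseʳ p {{≢-nonZero p≢0′}}

  *-invˡ : ∀ p → p ≢ 0ℚ → inv p * p ≡ 1ℚ
  *-invˡ p p≢0 = trans (*-comm (inv p) p) (*-invʳ p p≢0)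

  inv-pos : ∀ p → 0ℚ < p → 0ℚ < inv p
  inv-pos p 0<p with p ≟ 0ℚ
  ... | yes p≡0 = ⊥-elim (<-irrefl (sym p≡0) 0<p)
  ... | no _ = positive⁻¹ _ {{1/pos⇒pos p {{positive 0<p}}}}

  *-cancelˡ-≢0 : ∀ c {a b} → c ≢ 0ℚ → c * a ≡ c * b → a ≡ b
  *-cancelˡ-≢0 c {a} {b} c≢0 eq = begin
    a                ≡⟨ sym (*-identityˡ a) ⟩
    1ℚ * a           ≡⟨ cong (_* a) (sym (*-invˡ c c≢0)) ⟩
    (inv c * c) * a  ≡⟨ *-assoc (inv c) c a ⟩
    inv c * (c * a)  ≡⟨ cong (inv c *_) eq ⟩
    inv c * (c * b)  ≡⟨ sym (*-assoc (inv c) c b) ⟩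
    (inv c * c) * b  ≡⟨ cong (_* b) (*-invˡ c c≢0) ⟩
    1ℚ * b           ≡⟨ *-identityˡ b ⟩
    b                ∎
    where open ≡-Reasoning

  *≡⇒≡*inv : ∀ x p q → q ≢ 0ℚ → x * q ≡ p → x ≡ p * inv q
  *≡⇒≡*inv x p q q≢0 eq = *-cancelˡ-≢0 q q≢0 (begin
    q * x              ≡⟨ *-comm q x ⟩
    x * q              ≡⟨ eq ⟩
    p                  ≡⟨ sym (*-identityʳ p) ⟩
    p * 1ℚ             ≡⟨ cong (p *_) (sym (*-invʳ q q≢0)) ⟩
    p * (q * inv q)    ≡⟨ solve 3 (λ p q i → p :* (q :* i) := q :* (p :* i)) refl p q (inv q) ⟩
    q * (p * inv q)    ∎)
    where open ≡-Reasoning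

  *inv*-cancel : ∀ p q → q ≢ 0ℚ → (p * inv q) * q ≡ p
  *inv*-cancel p q q≢0 = begin
    (p * inv q) * q  ≡⟨ *-assoc p (inv q) q ⟩
    p * (inv q * q)  ≡⟨ cong (p *_) (*-invˡ q q≢0) ⟩
    p * 1ℚ           ≡⟨ *-identityʳ p ⟩
    p                ∎
    where open ≡-Reasoning

  *≡0⇒≡0 : ∀ a b → a ≢ 0ℚ → a * b ≡ 0ℚ → b ≡ 0ℚ
  *≡0⇒≡0 a b a≢0 eq = *-cancelˡ-≢0 a a≢0 (trans eq (sym (*-zeroʳ a)))

  *-≢0 : ∀ {a b} → a ≢ 0ℚ → b ≢ 0ℚ → a * b ≢ 0ℚ
  *-≢0 {a} {b} a≢0 b≢0 ab≡0 = b≢0 (*≡0⇒≡0 a b a≢0 ab≡0)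

  ∣inv∣ : ∀ p → ∣ inv p ∣ ≡ inv ∣ p ∣
  ∣inv∣ p = by-cases (p ≟ 0ℚ)
    where
    by-cases : Dec (p ≡ 0ℚ) → ∣ inv p ∣ ≡ inv ∣ p ∣
    by-cases (yes refl) = refl
    by-cases (no p≢0) = trans (*≡⇒≡*inv (∣ inv p ∣) 1ℚ (∣ p ∣) (λ e → p≢0 (∣p∣≡0⇒p≡0 p e)) ∣inv∣*∣p∣≡1) (*-identityˡ (inv ∣ p ∣))
      where
      ∣inv∣*∣p∣≡1 : ∣ inv p ∣ * ∣ p ∣ ≡ 1ℚ
      ∣inv∣*∣p∣≡1 = trans (sym (∣p*q∣≡∣p∣*∣q∣ (inv p) p)) (cong ∣_∣ (*-invˡ p p≢0))

  ∣*inv∣ : ∀ a b → ∣ a * inv b ∣ ≡ ∣ a ∣ * inv ∣ b ∣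
  ∣*inv∣ a b = trans (∣p*q∣≡∣p∣*∣q∣ a (inv b)) (cong (∣ a ∣ *_) (∣inv∣ b))

  ≢0⇒∣∣-pos : ∀ p → p ≢ 0ℚ → 0ℚ < ∣ p ∣
  ≢0⇒∣∣-pos p p≢0 with <-cmp 0ℚ ∣ p ∣
  ... | tri< 0<∣p∣ _ _ = 0<∣p∣
  ... | tri≈ _ 0≡∣p∣ _ = ⊥-elim (p≢0 (∣p∣≡0⇒p≡0 p (sym 0≡∣p∣)))
  ... | tri> _ _ ∣p∣<0 = ⊥-elim (<-irrefl refl (<-≤-trans ∣p∣<0 (0≤∣p∣ p)))

  0≤∣p∣+p : ∀ p → 0ℚ ≤ ∣ p ∣ + p
  0≤∣p∣+p p with ∣p∣≡p∨∣p∣≡-p p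
  ... | inj₁ ∣p∣≡p = subst (_≤ ∣ p ∣ + p) (+-identityˡ 0ℚ) (+-mono-≤ (0≤∣p∣ p) (subst (0ℚ ≤_) ∣p∣≡p (0≤∣p∣ p)))
  ... | inj₂ ∣p∣≡-p = subst (0ℚ ≤_) (sym (trans (cong (_+ p) ∣p∣≡-p) (+-inverseˡ p))) ≤-refl

  0≤∣p∣-p : ∀ p → 0ℚ ≤ ∣ p ∣ - p
  0≤∣p∣-p p = subst (λ w → 0ℚ ≤ w + (- p)) (∣-p∣≡∣p∣ p) (0≤∣p∣+p (- p))

  *-monoʳ-≤-0≤ : ∀ {p q} r → 0ℚ ≤ r → p ≤ q → p * r ≤ q * r
  *-monoʳ-≤-0≤ r 0≤r = *-monoʳ-≤-nonNeg r {{nonNegative 0≤r}}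

  *-monoˡ-≤-0≤ : ∀ {p q} r → 0ℚ ≤ r → p ≤ q → r * p ≤ r * q
  *-monoˡ-≤-0≤ r 0≤r = *-monoˡ-≤-nonNeg r {{nonNegative 0≤r}}

  *-monoʳ-<-0< : ∀ {p q} r → 0ℚ < r → p < q → p * r < q * r
  *-monoʳ-<-0< r 0<r = *-monoˡ-<-pos r {{positive 0<r}}

  *-monoˡ-<-0< : ∀ {p q} r → 0ℚ < r → p < q → r * p < r * q
  *-monoˡ-<-0< r 0<r = *-monoʳ-<-pos r {{positive 0<r}}

  *-mono-≤-0≤ : ∀ {a b c d} → 0ℚ ≤ a → 0ℚ ≤ c → a ≤ b → c ≤ d → a * c ≤ b * d
  *-mono-≤-0≤ {b = b} 0≤a 0≤c a≤b c≤d = ≤-trans (*-monoʳ-≤-0≤ _ 0≤c a≤b) (*-monoˡ-≤-0≤ b (≤-trans 0≤a a≤b) c≤d)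

  *-mono-≤-<-0< : ∀ {a b c d} → 0ℚ < a → 0ℚ < c → a ≤ b → c < d → a * c < b * d
  *-mono-≤-<-0< {a} {d = d} 0<a 0<c a≤b c<d =
    <-≤-trans (*-monoˡ-<-0< a 0<a c<d) (*-monoʳ-≤-0≤ d (<⇒≤ (<-trans 0<c c<d)) a≤b)

  0<*0< : ∀ {a b} → 0ℚ < a → 0ℚ < b → 0ℚ < a * b
  0<*0< {a} {b} 0<a 0<b = positive⁻¹ _ {{pos*pos⇒pos a {{positive 0<a}} b {{positive 0<b}}}}

  0≤*0≤ : ∀ {a b} → 0ℚ ≤ a → 0ℚ ≤ b → 0ℚ ≤ a * b
  0≤*0≤ {a} {b} 0≤a 0≤b = nonNegative⁻¹ _ {{nonNeg*nonNeg⇒nonNeg a {{nonNegative 0≤a}} b {{nonNegative 0≤b}}}}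

  0≤½ : 0ℚ ≤ ½
  0≤½ = *≤* (ℤ.+≤+ z≤n)

  0<1 : 0ℚ < 1ℚ
  0<1 = *<* (ℤ.+<+ (s≤s z≤n))

  private
    cross-cancel : ∀ a b b′ → b ≢ 0ℚ → b′ ≢ 0ℚ → (a * b′) * (inv b * inv b′) ≡ a * inv b
    cross-cancel a b b′ b≢0 b′≢0 = begin
      (a * b′) * (inv b * inv b′)  ≡⟨ solve 4 (λ a b′ i i′ → (a :* b′) :* (i :* i′) := (a :* i) :* (b′ :* i′)) refl a b′ (inv b) (inv b′) ⟩
      (a * inv b) * (b′ * inv b′)  ≡⟨ cong ((a * inv b) *_) (*-invʳ b′ b′≢0) ⟩
      (a * inv b) * 1ℚ             ≡⟨ *-identityʳ _ ⟩
      a * inv b                    ∎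
      where open ≡-Reasoning

    0<⇒≢0 : ∀ {b} → 0ℚ < b → b ≢ 0ℚ
    0<⇒≢0 0<b b≡0 = <-irrefl (sym b≡0) 0<b

  *inv-mono-≤ : ∀ a a′ b b′ → 0ℚ < b → 0ℚ < b′ → a * b′ ≤ a′ * b → a * inv b ≤ a′ * inv b′
  *inv-mono-≤ a a′ b b′ 0<b 0<b′ le = subst₂ _≤_
    (cross-cancel a b b′ (0<⇒≢0 0<b) (0<⇒≢0 0<b′))
    (trans (cong ((a′ * b) *_) (*-comm (inv b) (inv b′))) (cross-cancel a′ b′ b (0<⇒≢0 0<b′) (0<⇒≢0 0<b)))
    (*-monoʳ-≤-0≤ (inv b * inv b′) (<⇒≤ (0<*0< (inv-pos b 0<b) (inv-pos b′ 0<b′))) le)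

  *inv-antimono-< : ∀ a b b′ → 0ℚ < a → 0ℚ < b → b < b′ → a * inv b′ < a * inv b
  *inv-antimono-< a b b′ 0<a 0<b b<b′ = subst₂ _<_
    (trans (cong ((a * b) *_) (*-comm (inv b) (inv b′))) (cross-cancel a b′ b (0<⇒≢0 0<b′) (0<⇒≢0 0<b)))
    (cross-cancel a b b′ (0<⇒≢0 0<b) (0<⇒≢0 0<b′))
    (*-monoʳ-<-0< (inv b * inv b′) (0<*0< (inv-pos b 0<b) (inv-pos b′ 0<b′)) (*-monoˡ-<-0< a 0<a b<b′))
    where 0<b′ = <-trans 0<b b<b′

  nonzero : ℚ → Bool
  nonzero p = not ⌊ p ≟ 0ℚ ⌋

  nonzero-false : ∀ p → nonzero p ≡ false → p ≡ 0ℚ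
  nonzero-false p eq with p ≟ 0ℚ
  nonzero-false p ()  | no _
  ... | yes p≡0 = p≡0

  -0≡0 : - 0ℚ ≡ 0ℚ
  -0≡0 = refl

  p-0≡p : ∀ p → p - 0ℚ ≡ p
  p-0≡p p = trans (cong (λ q → p + q) -0≡0) (+-identityʳ p)

module BigOperators where

  open import Data.Nat as ℕ using (ℕ; zero; suc; z≤n; s≤s; _≡ᵇ_)
  import Data.Nat.Properties as ℕP
  open import Data.Bool using (Bool; true; false; if_then_else_; _∧_; _∨_; not; T)
  open import Data.Bool.Properties using (∧-identityʳ; ∧-zeroʳ; ∨-identityʳ; ∨-zeroʳ)
  open import Data.Rational using (ℚ; 0ℚ; 1ℚ; _+_; _*_; _-_; _≤_; _<_; ∣_∣)
  open import Data.Rational.Properties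
  open import Data.Rational.Solver using (module +-*-Solver)
  open import Data.Product using (Σ-syntax; _×_; _,_)
  open import Function using (_∘_)
  open import Relation.Binary.PropositionalEquality
  open import Relation.Nullary using (yes; no)
  open import Data.Empty using (⊥-elim)
  open Rationals
  open ≡-Reasoning
  open +-*-Solver

  private
    below : ∀ {n} {P : ℕ → Set} → (∀ i → i ℕ.< suc n → P i) → ∀ i → i ℕ.< n → P i
    below h i i<n = h i (ℕP.m≤n⇒m≤1+n i<n)

    top : ∀ {n} {P : ℕ → Set} → (∀ i → i ℕ.< suc n → P i) → P n
    top h = h _ ℕP.≤-refl

    <-suc-≢ : ∀ {i n} → i ℕ.< suc n → i ≢ n → i ℕ.< n
    <-suc-≢ i<1+n i≢n = ℕP.≤∧≢⇒< (ℕP.≤-pred i<1+n) i≢n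

  ∑ : ℕ → (ℕ → ℚ) → ℚ
  ∑ zero    f = 0ℚ
  ∑ (suc n) f = ∑ n f + f n


  ∑-cong : ∀ n {f g} → (∀ i → i ℕ.< n → f i ≡ g i) → ∑ n f ≡ ∑ n g
  ∑-cong zero    eq = refl
  ∑-cong (suc n) eq = cong₂ _+_ (∑-cong n (below eq)) (top eq)

  ∑-zero : ∀ n {f} → (∀ i → i ℕ.< n → f i ≡ 0ℚ) → ∑ n f ≡ 0ℚ
  ∑-zero zero    eq = refl
  ∑-zero (suc n) eq = trans (cong₂ _+_ (∑-zero n (below eq)) (top eq)) (+-identityˡ 0ℚ)

  ∑-distrib-+ : ∀ n f g → ∑ n (λ i → f i + g i) ≡ ∑ n f + ∑ n g
  ∑-distrib-+ zero    f g = sym (+-identityˡ 0ℚ)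
  ∑-distrib-+ (suc n) f g = begin
    ∑ n (λ i → f i + g i) + (f n + g n)  ≡⟨ cong (_+ (f n + g n)) (∑-distrib-+ n f g) ⟩
    (∑ n f + ∑ n g) + (f n + g n)        ≡⟨ solve 4 (λ a b c d → (a :+ b) :+ (c :+ d) := (a :+ c) :+ (b :+ d)) refl (∑ n f) (∑ n g) (f n) (g n) ⟩
    (∑ n f + f n) + (∑ n g + g n)        ∎

  ∑-factorˡ : ∀ n c f → ∑ n (λ i → c * f i) ≡ c * ∑ n f
  ∑-factorˡ zero    c f = sym (*-zeroʳ c)
  ∑-factorˡ (suc n) c f = trans (cong (_+ c * f n) (∑-factorˡ n c f)) (sym (*-distribˡ-+ c (∑ n f) (f n)))

  ∑-factorʳ : ∀ n c f → ∑ n (λ i → f i * c) ≡ ∑ n f * c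
  ∑-factorʳ n c f = trans (∑-cong n (λ i _ → *-comm (f i) c)) (trans (∑-factorˡ n c f) (*-comm c (∑ n f)))

  ∑-distrib-- : ∀ n f g → ∑ n (λ i → f i - g i) ≡ ∑ n f - ∑ n g
  ∑-distrib-- zero    f g = sym (+-inverseʳ 0ℚ)
  ∑-distrib-- (suc n) f g = begin
    ∑ n (λ i → f i - g i) + (f n - g n)  ≡⟨ cong (_+ (f n - g n)) (∑-distrib-- n f g) ⟩
    (∑ n f - ∑ n g) + (f n - g n)        ≡⟨ solve 4 (λ a b c d → (a :- b) :+ (c :- d) := (a :+ c) :- (b :+ d)) refl (∑ n f) (∑ n g) (f n) (g n) ⟩
    (∑ n f + f n) - (∑ n g + g n)        ∎

  ∑-unfoldˡ : ∀ n f → ∑ (suc n) f ≡ f 0 + ∑ n (f ∘ suc)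
  ∑-unfoldˡ zero    f = trans (+-identityˡ (f 0)) (sym (+-identityʳ (f 0)))
  ∑-unfoldˡ (suc n) f = trans (cong (_+ f (suc n)) (∑-unfoldˡ n f)) (+-assoc (f 0) _ (f (suc n)))

  ∑-comm : ∀ n m (f : ℕ → ℕ → ℚ) → ∑ n (λ i → ∑ m (f i)) ≡ ∑ m (λ j → ∑ n (λ i → f i j))
  ∑-comm zero    m f = sym (∑-zero m (λ _ _ → refl))
  ∑-comm (suc n) m f =
    trans (cong (_+ ∑ m (f n)) (∑-comm n m f)) (sym (∑-distrib-+ m (λ j → ∑ n (λ i → f i j)) (f n)))

  ∑-single : ∀ n a {f} → a ℕ.< n → (∀ i → i ℕ.< n → i ≢ a → f i ≡ 0ℚ) → ∑ n f ≡ f a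
  ∑-single zero    a () _
  ∑-single (suc n) a {f} a<1+n others with a ℕ.≟ n
  ... | yes refl = trans (cong (_+ f a) (∑-zero n (λ i i<n → below others i i<n (ℕP.<⇒≢ i<n)))) (+-identityˡ (f a))
  ... | no a≢n = trans (cong₂ _+_ (∑-single n a (<-suc-≢ a<1+n a≢n) (below others)) (top others (a≢n ∘ sym)))
                       (+-identityʳ (f a))

  ∑-extend : ∀ m n f → m ℕ.≤ n → (∀ i → m ℕ.≤ i → i ℕ.< n → f i ≡ 0ℚ) → ∑ m f ≡ ∑ n f
  ∑-extend m zero    f z≤n  _     = refl
  ∑-extend m (suc n) f m≤1+n zeros with m ℕ.≟ suc n
  ... | yes refl = refl
  ... | no m≢1+n = begin
    ∑ m f          ≡⟨ ∑-extend m n f m≤n (λ i m≤i i<n → zeros i m≤i (ℕP.m≤n⇒m≤1+n i<n)) ⟩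
    ∑ n f          ≡⟨ sym (+-identityʳ (∑ n f)) ⟩
    ∑ n f + 0ℚ     ≡⟨ cong (∑ n f +_) (sym (zeros n m≤n ℕP.≤-refl)) ⟩
    ∑ n f + f n    ∎
    where m≤n = ℕP.≤-pred (ℕP.≤∧≢⇒< m≤1+n m≢1+n)

  ∑-split-single : ∀ n (p : ℕ → Bool) f c → c ℕ.< n → p c ≡ false → (∀ i → i ℕ.< n → i ≢ c → p i ≡ false → f i ≡ 0ℚ) →
                   ∑ n f ≡ ∑ n (λ i → if p i then f i else 0ℚ) + f c
  ∑-split-single n p f c c<n pc others = begin
    ∑ n f                                                                   ≡⟨ ∑-cong n split ⟩
    ∑ n (λ i → (if p i then f i else 0ℚ) + (if p i then 0ℚ else f i))       ≡⟨ ∑-distrib-+ n _ _ ⟩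
    ∑ n (λ i → if p i then f i else 0ℚ) + ∑ n (λ i → if p i then 0ℚ else f i) ≡⟨ cong (∑ n (λ i → if p i then f i else 0ℚ) +_) (∑-single n c c<n rest) ⟩
    ∑ n (λ i → if p i then f i else 0ℚ) + (if p c then 0ℚ else f c)         ≡⟨ cong (λ b → ∑ n (λ i → if p i then f i else 0ℚ) + (if b then 0ℚ else f c)) pc ⟩
    ∑ n (λ i → if p i then f i else 0ℚ) + f c                               ∎
    where
    split : ∀ i → i ℕ.< n → f i ≡ (if p i then f i else 0ℚ) + (if p i then 0ℚ else f i)
    split i _ with p i
    ... | true  = sym (+-identityʳ (f i))
    ... | false = sym (+-identityˡ (f i))
    rest : ∀ i → i ℕ.< n → i ≢ c → (if p i then 0ℚ else f i) ≡ 0ℚ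
    rest i i<n i≢c with p i in pi
    ... | true  = refl
    ... | false = others i i<n i≢c pi

  ∑-mono-≤ : ∀ n {f g} → (∀ i → i ℕ.< n → f i ≤ g i) → ∑ n f ≤ ∑ n g
  ∑-mono-≤ zero    le = ≤-refl
  ∑-mono-≤ (suc n) le = +-mono-≤ (∑-mono-≤ n (below le)) (top le)

  -- Case analysis on b that leaves the goal untouched; with-abstraction would normalise goals full of ℚ arithmetic.
  bool-cases : ∀ {ℓ} {A : Set ℓ} b → (b ≡ true → A) → (b ≡ false → A) → A
  bool-cases true  on-true on-false = on-true refl
  bool-cases false on-true on-false = on-false refl

  true≢false-at : ∀ {a b} (p : ℕ → Bool) → p a ≡ true → p b ≡ false → a ≢ b
  true≢false-at p pa pb refl with () ← trans (sym pb) pa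

  delete : ℕ → (ℕ → Bool) → ℕ → Bool
  delete t p l = p l ∧ not (l ≡ᵇ t)

  insert : ℕ → (ℕ → Bool) → ℕ → Bool
  insert e p l = p l ∨ (l ≡ᵇ e)

  private
    ≡ᵇ-refl : ∀ t → (t ≡ᵇ t) ≡ true
    ≡ᵇ-refl zero    = refl
    ≡ᵇ-refl (suc t) = ≡ᵇ-refl t

    ≡ᵇ-≢ : ∀ {l t} → l ≢ t → (l ≡ᵇ t) ≡ false
    ≡ᵇ-≢ {l} {t} l≢t with l ≡ᵇ t in eq
    ... | true  = ⊥-elim (l≢t (ℕP.≡ᵇ⇒≡ l t (subst T (sym eq) _)))
    ... | false = refl

  delete-self : ∀ t p → delete t p t ≡ false
  delete-self t p rewrite ≡ᵇ-refl t = ∧-zeroʳ (p t)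

  delete-other : ∀ {t l} p → l ≢ t → delete t p l ≡ p l
  delete-other p l≢t rewrite ≡ᵇ-≢ l≢t = ∧-identityʳ (p _)

  delete-≢ : ∀ {t l} p → delete t p l ≡ true → l ≢ t
  delete-≢ {t} p eq refl with () ← trans (sym (delete-self t p)) eq

  delete-cong : ∀ t {l} {p q : ℕ → Bool} → p l ≡ q l → delete t p l ≡ delete t q l
  delete-cong t {l} eq = cong (_∧ not (l ≡ᵇ t)) eq

  delete-∉ : ∀ t {l} (p : ℕ → Bool) → p l ≡ false → delete t p l ≡ false
  delete-∉ t p = delete-cong t {p = p}

  delete-⊆ : ∀ {t l} p → delete t p l ≡ true → p l ≡ true
  delete-⊆ {t} {l} p eq = trans (sym (delete-other p (delete-≢ p eq))) eq

  insert-self : ∀ e p → insert e p e ≡ true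
  insert-self e p rewrite ≡ᵇ-refl e = ∨-zeroʳ (p e)

  insert-other : ∀ {e l} p → l ≢ e → insert e p l ≡ p l
  insert-other p l≢e rewrite ≡ᵇ-≢ l≢e = ∨-identityʳ (p _)

  insert-delete : ∀ {e} p l → p e ≡ true → insert e (delete e p) l ≡ p l
  insert-delete {e} p l pe with l ℕ.≟ e
  ... | yes refl = trans (insert-self l (delete l p)) (sym pe)
  ... | no l≢e = trans (insert-other (delete e p) l≢e) (delete-other p l≢e)

  delete-insert : ∀ {t e} p l → t ≢ e → delete t (insert e p) l ≡ insert e (delete t p) l
  delete-insert {t} {e} p l t≢e with l ℕ.≟ e
  ... | yes refl = trans (delete-other (insert l p) (t≢e ∘ sym)) (trans (insert-self l p) (sym (insert-self l (delete t p))))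
  ... | no l≢e = trans (cong (_∧ not (l ≡ᵇ t)) (insert-other p l≢e)) (sym (insert-other (delete t p) l≢e))

  delete-insert-self : ∀ {e} p l → p e ≡ false → delete e (insert e p) l ≡ p l
  delete-insert-self {e} p l pe with l ℕ.≟ e
  ... | yes refl = trans (delete-self l (insert l p)) (sym pe)
  ... | no l≢e = trans (delete-other (insert e p) l≢e) (insert-other p l≢e)

  count : ℕ → (ℕ → Bool) → ℕ
  count zero    p = 0
  count (suc n) p = if p n then suc (count n p) else count n p

  count-cong : ∀ n {p q} → (∀ i → i ℕ.< n → p i ≡ q i) → count n p ≡ count n q
  count-cong zero    eq = refl
  count-cong (suc n) {p} {q} eq rewrite top eq with q n
  ... | true  = cong suc (count-cong n (below eq))
  ... | false = count-cong n (below eq)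

  count-delete : ∀ n t p → t ℕ.< n → p t ≡ true → suc (count n (delete t p)) ≡ count n p
  count-delete zero    t p () _
  count-delete (suc n) t p t<1+n pt with t ℕ.≟ n
  ... | yes refl rewrite delete-self t p | pt = cong suc (count-cong t (λ i i<t → delete-other p (ℕP.<⇒≢ i<t)))
  ... | no t≢n rewrite delete-other p (t≢n ∘ sym) with p n
  ...   | true  = cong suc (count-delete n t p (<-suc-≢ t<1+n t≢n) pt)
  ...   | false = count-delete n t p (<-suc-≢ t<1+n t≢n) pt

  count-insert : ∀ n e p → e ℕ.< n → p e ≡ false → count n (insert e p) ≡ suc (count n p)
  count-insert zero    e p () _
  count-insert (suc n) e p e<1+n pe with e ℕ.≟ n
  ... | yes refl rewrite insert-self e p | pe = cong suc (count-cong e (λ i i<e → insert-other p (ℕP.<⇒≢ i<e)))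
  ... | no e≢n rewrite insert-other p (e≢n ∘ sym) with p n
  ...   | true  = cong suc (count-insert n e p (<-suc-≢ e<1+n e≢n) pe)
  ...   | false = count-insert n e p (<-suc-≢ e<1+n e≢n) pe

  private
    <-suc-cases : ∀ {n} {P : ℕ → Set} → (∀ l → l ℕ.< n → P l) → P n → ∀ l → l ℕ.< suc n → P l
    <-suc-cases {n} below-n at-n l l<1+n with l ℕ.≟ n
    ... | yes refl = at-n
    ... | no l≢n = below-n l (<-suc-≢ l<1+n l≢n)

    count≡0⇒none : ∀ n p → count n p ≡ 0 → ∀ l → l ℕ.< n → p l ≡ false
    count≡0⇒none (suc n) p c≡0 with p n in pn
    ... | false = <-suc-cases (count≡0⇒none n p c≡0) pn

  greatest : ∀ n p → 0 ℕ.< count n p →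
             Σ[ a ∈ ℕ ] a ℕ.< n × p a ≡ true × (∀ l → l ℕ.< n → p l ≡ true → l ℕ.≤ a)
  greatest zero    p ()
  greatest (suc n) p pos with p n in pn
  ... | true  = n , ℕP.≤-refl , pn , (λ l l<1+n _ → ℕP.≤-pred l<1+n)
  ... | false = let (a , a<n , pa , max) = greatest n p pos in
    a , ℕP.m≤n⇒m≤1+n a<n , pa , <-suc-cases max (λ pn≡true → ⊥-elim (true≢false-at p pn≡true pn refl))

  least : ∀ n p → 0 ℕ.< count n p →
          Σ[ b ∈ ℕ ] b ℕ.< n × p b ≡ true × (∀ l → l ℕ.< n → p l ≡ true → b ℕ.≤ l)
  least zero    p ()
  least (suc n) p pos with count n p in cn
  ... | suc _ = let (b , b<n , pb , min) = least n p (subst (0 ℕ.<_) (sym cn) (s≤s z≤n)) in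
    b , ℕP.m≤n⇒m≤1+n b<n , pb , <-suc-cases min (λ _ → ℕP.<⇒≤ b<n)
  ... | zero with p n in pn
  ...   | true  = n , ℕP.≤-refl , pn , <-suc-cases none-below (λ _ → ℕP.≤-refl)
    where
    none-below : ∀ l → l ℕ.< n → p l ≡ true → n ℕ.≤ l
    none-below l l<n pl with () ← trans (sym (count≡0⇒none n p cn l l<n)) pl
  ...   | false = ⊥-elim (ℕP.<-irrefl refl pos)

  ∏ : ℕ → (ℕ → Bool) → (ℕ → ℚ) → ℚ
  ∏ zero    p g = 1ℚ
  ∏ (suc n) p g = if p n then ∏ n p g * g n else ∏ n p g

  ∏-cong : ∀ n {p p′ g g′} → (∀ l → l ℕ.< n → p l ≡ p′ l) → (∀ l → l ℕ.< n → p l ≡ true → g l ≡ g′ l) →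
           ∏ n p g ≡ ∏ n p′ g′
  ∏-cong zero    _   _   = refl
  ∏-cong (suc n) {p} {p′} eqp eqg rewrite sym (top eqp) with p n in pn
  ... | true  = cong₂ _*_ (∏-cong n (below eqp) (below eqg)) (top eqg pn)
  ... | false = ∏-cong n (below eqp) (below eqg)

  ∏-zero : ∀ n p g l → l ℕ.< n → p l ≡ true → g l ≡ 0ℚ → ∏ n p g ≡ 0ℚ
  ∏-zero zero    p g l () _ _
  ∏-zero (suc n) p g l l<1+n pl gl with l ℕ.≟ n
  ... | yes refl rewrite pl = trans (cong (∏ l p g *_) gl) (*-zeroʳ (∏ l p g))
  ... | no l≢n with p n
  ...   | true  = trans (cong (_* g n) (∏-zero n p g l (<-suc-≢ l<1+n l≢n) pl gl)) (*-zeroˡ (g n))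
  ...   | false = ∏-zero n p g l (<-suc-≢ l<1+n l≢n) pl gl

  ∏-≢0 : ∀ n p g → (∀ l → l ℕ.< n → p l ≡ true → g l ≢ 0ℚ) → ∏ n p g ≢ 0ℚ
  ∏-≢0 zero    p g _ ()
  ∏-≢0 (suc n) p g nz with p n in pn
  ... | true  = *-≢0 (∏-≢0 n p g (below nz)) (top nz pn)
  ... | false = ∏-≢0 n p g (below nz)

  ∏-pos : ∀ n p g → (∀ l → l ℕ.< n → p l ≡ true → 0ℚ < g l) → 0ℚ < ∏ n p g
  ∏-pos zero    p g _   = 0<1
  ∏-pos (suc n) p g pos with p n in pn
  ... | true  = 0<*0< (∏-pos n p g (below pos)) (top pos pn)
  ... | false = ∏-pos n p g (below pos)

  ∣∏∣ : ∀ n p g → ∣ ∏ n p g ∣ ≡ ∏ n p (λ l → ∣ g l ∣)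
  ∣∏∣ zero    p g = refl
  ∣∏∣ (suc n) p g with p n
  ... | true  = trans (∣p*q∣≡∣p∣*∣q∣ (∏ n p g) (g n)) (cong (_* ∣ g n ∣) (∣∏∣ n p g))
  ... | false = ∣∏∣ n p g

  ∏-insert : ∀ n p g e → e ℕ.< n → p e ≡ false → ∏ n (insert e p) g ≡ g e * ∏ n p g
  ∏-insert zero    p g e () _
  ∏-insert (suc n) p g e e<1+n pe with e ℕ.≟ n
  ... | yes refl rewrite insert-self e p | pe =
    trans (*-comm _ (g e)) (cong (g e *_) (∏-cong e (λ l l<e → insert-other p (ℕP.<⇒≢ l<e)) (λ _ _ _ → refl)))
  ... | no e≢n rewrite insert-other p (e≢n ∘ sym) with p n
  ...   | true  = trans (cong (_* g n) (∏-insert n p g e (<-suc-≢ e<1+n e≢n) pe)) (*-assoc (g e) _ (g n))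
  ...   | false = ∏-insert n p g e (<-suc-≢ e<1+n e≢n) pe

  ∏-mono-≤ : ∀ n p f g → (∀ l → l ℕ.< n → p l ≡ true → 0ℚ < f l) → (∀ l → l ℕ.< n → p l ≡ true → f l ≤ g l) →
             ∏ n p f ≤ ∏ n p g
  ∏-mono-≤ zero    p f g _   _  = ≤-refl
  ∏-mono-≤ (suc n) p f g pos le with p n in pn
  ... | true  = *-mono-≤-0≤ (<⇒≤ (∏-pos n p f (below pos))) (<⇒≤ (top pos pn)) (∏-mono-≤ n p f g (below pos) (below le)) (top le pn)
  ... | false = ∏-mono-≤ n p f g (below pos) (below le)

  ∏-mono-< : ∀ n p f g → (∀ l → l ℕ.< n → p l ≡ true → 0ℚ < f l) → (∀ l → l ℕ.< n → p l ≡ true → f l < g l) →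
             0 ℕ.< count n p → ∏ n p f < ∏ n p g
  ∏-mono-< zero    p f g _   _  ()
  ∏-mono-< (suc n) p f g pos lt nonempty with p n in pn
  ... | true  = *-mono-≤-<-0< (∏-pos n p f (below pos)) (top pos pn)
                  (∏-mono-≤ n p f g (below pos) (λ l l<n pl → <⇒≤ (below lt l l<n pl))) (top lt pn)
  ... | false = ∏-mono-< n p f g (below pos) (below lt) nonempty

module Binomials where

  open import Data.Nat
  open import Data.Nat.Properties
  open import Data.Nat.Combinatorics using (_C_; nCk+nC[k+1]≡[n+1]C[k+1])
  import Data.Nat.Solver as ℕSolver
  import Data.Rational.Solver as ℚSolver
  import Data.Integer as ℤ
  import Data.Integer.Properties as ℤP
  open import Data.Rational as ℚ using (ℚ)
  import Data.Rational.Properties as ℚP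
  open import Relation.Binary.PropositionalEquality
  open import Defs using (binom; ℕ→ℚ)
  open Rationals
  open BigOperators

  -- The library's _C_ is defined through factorials; this copy computes by Pascal's rule.
  choose : ℕ → ℕ → ℕ
  choose n       zero    = 1
  choose zero    (suc k) = 0
  choose (suc n) (suc k) = choose n k + choose n (suc k)

  C≡choose : ∀ n k → n C k ≡ choose n k
  C≡choose n       zero    = refl
  C≡choose zero    (suc k) = refl
  C≡choose (suc n) (suc k) =
    trans (sym (nCk+nC[k+1]≡[n+1]C[k+1] n k)) (cong₂ _+_ (C≡choose n k) (C≡choose n (suc k)))

  choose-> : ∀ n k → n < k → choose n k ≡ 0
  choose-> zero    (suc k) _         = refl
  choose-> (suc n) (suc k) (s≤s n<k) = cong₂ _+_ (choose-> n k n<k) (choose-> n (suc k) (m≤n⇒m≤1+n n<k))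

  choose-n-n : ∀ n → choose n n ≡ 1
  choose-n-n zero    = refl
  choose-n-n (suc n) = cong₂ _+_ (choose-n-n n) (choose-> n (suc n) ≤-refl)

  choose-pos : ∀ n k → k ≤ n → 0 < choose n k
  choose-pos n       zero    _         = s≤s z≤n
  choose-pos (suc n) (suc k) (s≤s k≤n) = <-≤-trans (choose-pos n k k≤n) (m≤m+n (choose n k) _)

  choose-n-1 : ∀ n → choose n 1 ≡ n
  choose-n-1 zero    = refl
  choose-n-1 (suc n) = cong suc (choose-n-1 n)

  choose-absorption : ∀ n k → suc k * choose (suc n) (suc k) ≡ suc n * choose n k
  choose-absorption zero    zero    = refl
  choose-absorption zero    (suc k) = trans (cong (suc (suc k) *_) (choose-> 1 (suc (suc k)) (s≤s (s≤s z≤n)))) (*-zeroʳ (suc (suc k)))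
  choose-absorption (suc n) zero    = trans (+-identityʳ _) (trans (choose-n-1 (suc (suc n))) (sym (*-identityʳ (suc (suc n)))))
  choose-absorption (suc n) (suc k) = begin
    suc (suc k) * (choose (suc n) (suc k) + choose (suc n) (suc (suc k)))
      ≡⟨ *-distribˡ-+ (suc (suc k)) (choose (suc n) (suc k)) _ ⟩
    suc (suc k) * choose (suc n) (suc k) + suc (suc k) * choose (suc n) (suc (suc k))
      ≡⟨ cong₂ (λ a b → choose (suc n) (suc k) + a + b) (choose-absorption n k) (choose-absorption n (suc k)) ⟩
    choose (suc n) (suc k) + suc n * choose n k + suc n * choose n (suc k)
      ≡⟨ +-assoc (choose (suc n) (suc k)) _ _ ⟩
    choose (suc n) (suc k) + (suc n * choose n k + suc n * choose n (suc k))
      ≡⟨ cong (choose (suc n) (suc k) +_) (sym (*-distribˡ-+ (suc n) (choose n k) (choose n (suc k)))) ⟩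
    choose (suc n) (suc k) + suc n * choose (suc n) (suc k) ∎
    where open ≡-Reasoning

  choose-shift : ∀ s j → s * choose s j ≡ suc j * choose s (suc j) + j * choose s j
  choose-shift s j = +-cancelˡ-≡ (choose s j) _ _ (begin
    choose s j + s * choose s j                          ≡⟨ sym (choose-absorption s j) ⟩
    suc j * (choose s j + choose s (suc j))              ≡⟨ *-distribˡ-+ (suc j) (choose s j) _ ⟩
    choose s j + j * choose s j + suc j * choose s (suc j) ≡⟨ +-assoc (choose s j) _ _ ⟩
    choose s j + (j * choose s j + suc j * choose s (suc j)) ≡⟨ cong (choose s j +_) (+-comm (j * choose s j) _) ⟩
    choose s j + (suc j * choose s (suc j) + j * choose s j) ∎)
    where open ≡-Reasoning

  -- C(N, i - h) for integer i - h, so it vanishes for i < h (unlike choose N (i ∸ h)).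
  choose-offset : ℕ → ℕ → ℕ → ℕ
  choose-offset N i       zero    = choose N i
  choose-offset N zero    (suc h) = 0
  choose-offset N (suc i) (suc h) = choose-offset N i h

  binom≡choose-offset : ∀ N i h → binom N (ℤ.+ i ℤ.- ℤ.+ h) ≡ choose-offset N i h
  binom≡choose-offset N i h = trans (cong (binom N) (ℤP.m-n≡m⊖n i h)) (go N i h)
    where
    go : ∀ N i h → binom N (i ℤ.⊖ h) ≡ choose-offset N i h
    go N i       zero    = C≡choose N i
    go N zero    (suc h) = refl
    go N (suc i) (suc h) = trans (cong (binom N) (ℤP.[1+m]⊖[1+n]≡m⊖n i h)) (go N i h)

  choose-offset-pascal : ∀ M i j → choose-offset (suc M) i j ≡ choose-offset M i j + choose-offset M i (suc j)
  choose-offset-pascal M zero    zero    = refl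
  choose-offset-pascal M (suc i) zero    = +-comm (choose M i) (choose M (suc i))
  choose-offset-pascal M zero    (suc j) = refl
  choose-offset-pascal M (suc i) (suc j) = choose-offset-pascal M i j

  choose-subset : ∀ ν i j → choose ν i * choose i j ≡ choose ν j * choose-offset (ν ∸ j) i j
  choose-subset ν       i       zero    = trans (*-identityʳ (choose ν i)) (sym (+-identityʳ (choose ν i)))
  choose-subset ν       zero    (suc j) = sym (*-zeroʳ (choose ν (suc j)))
  choose-subset zero    (suc i) (suc j) = refl
  choose-subset (suc ν) (suc i) (suc j) = *-cancelˡ-≡ _ _ (suc j * suc i) (begin
    suc j * suc i * (choose (suc ν) (suc i) * choose (suc i) (suc j))
      ≡⟨ solve 4 (λ a b c d → a :* b :* (c :* d) := (b :* c) :* (a :* d)) refl (suc j) (suc i) (choose (suc ν) (suc i)) (choose (suc i) (suc j)) ⟩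
    (suc i * choose (suc ν) (suc i)) * (suc j * choose (suc i) (suc j))
      ≡⟨ cong₂ _*_ (choose-absorption ν i) (choose-absorption i j) ⟩
    (suc ν * choose ν i) * (suc i * choose i j)
      ≡⟨ solve 4 (λ a b c d → (a :* b) :* (c :* d) := c :* (a :* (b :* d))) refl (suc ν) (choose ν i) (suc i) (choose i j) ⟩
    suc i * (suc ν * (choose ν i * choose i j))
      ≡⟨ cong (λ w → suc i * (suc ν * w)) (choose-subset ν i j) ⟩
    suc i * (suc ν * (choose ν j * choose-offset (ν ∸ j) i j))
      ≡⟨ cong (suc i *_) (sym (*-assoc (suc ν) (choose ν j) _)) ⟩
    suc i * ((suc ν * choose ν j) * choose-offset (ν ∸ j) i j)
      ≡⟨ cong (λ w → suc i * (w * choose-offset (ν ∸ j) i j)) (sym (choose-absorption ν j)) ⟩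
    suc i * ((suc j * choose (suc ν) (suc j)) * choose-offset (ν ∸ j) i j)
      ≡⟨ solve 4 (λ a b c d → a :* ((b :* c) :* d) := b :* a :* (c :* d)) refl (suc i) (suc j) (choose (suc ν) (suc j)) (choose-offset (ν ∸ j) i j) ⟩
    suc j * suc i * (choose (suc ν) (suc j) * choose-offset (ν ∸ j) i j) ∎)
    where
    open ≡-Reasoning
    open ℕSolver.+-*-Solver

  Cℚ : ℕ → ℕ → ℚ
  Cℚ n k = ℕ→ℚ (choose n k)

  Cℚ-shift : ∀ s j → ℕ→ℚ s ℚ.* Cℚ s j ≡ ℕ→ℚ (suc j) ℚ.* Cℚ s (suc j) ℚ.+ ℕ→ℚ j ℚ.* Cℚ s j
  Cℚ-shift s j = begin
    ℕ→ℚ s ℚ.* Cℚ s j                                        ≡⟨ sym (ℕ→ℚ-* s (choose s j)) ⟩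
    ℕ→ℚ (s * choose s j)                                    ≡⟨ cong ℕ→ℚ (choose-shift s j) ⟩
    ℕ→ℚ (suc j * choose s (suc j) + j * choose s j)         ≡⟨ ℕ→ℚ-+ (suc j * choose s (suc j)) (j * choose s j) ⟩
    ℕ→ℚ (suc j * choose s (suc j)) ℚ.+ ℕ→ℚ (j * choose s j) ≡⟨ cong₂ ℚ._+_ (ℕ→ℚ-* (suc j) (choose s (suc j))) (ℕ→ℚ-* j (choose s j)) ⟩
    ℕ→ℚ (suc j) ℚ.* Cℚ s (suc j) ℚ.+ ℕ→ℚ j ℚ.* Cℚ s j       ∎
    where open ≡-Reasoning

  Cℚ-offset : ℕ → ℕ → ℕ → ℚ
  Cℚ-offset N i h = ℕ→ℚ (choose-offset N i h)

  vandermonde : ∀ K N i j → ∑ (suc K) (λ m → Cℚ K m ℚ.* Cℚ-offset N i (j + m)) ≡ Cℚ-offset (N + K) i j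
  vandermonde zero    N i j = begin
    ℚ.0ℚ ℚ.+ ℚ.1ℚ ℚ.* Cℚ-offset N i (j + 0) ≡⟨ trans (ℚP.+-identityˡ _) (ℚP.*-identityˡ _) ⟩
    Cℚ-offset N i (j + 0)                    ≡⟨ cong₂ (λ N′ j′ → Cℚ-offset N′ i j′) (sym (+-identityʳ N)) (+-identityʳ j) ⟩
    Cℚ-offset (N + 0) i j                    ∎
    where open ≡-Reasoning
  vandermonde (suc K) N i j = begin
    ∑ (suc (suc K)) g
      ≡⟨ ∑-unfoldˡ (suc K) g ⟩
    g 0 ℚ.+ ∑ (suc K) (λ m → Cℚ (suc K) (suc m) ℚ.* Cℚ-offset N i (j + suc m))
      ≡⟨ cong (g 0 ℚ.+_) (∑-cong (suc K) (λ m _ → pascal m)) ⟩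
    g 0 ℚ.+ ∑ (suc K) (λ m → h (suc j) m ℚ.+ h′ m)
      ≡⟨ cong (g 0 ℚ.+_) (∑-distrib-+ (suc K) (h (suc j)) h′) ⟩
    g 0 ℚ.+ (∑ (suc K) (h (suc j)) ℚ.+ ∑ (suc K) h′)
      ≡⟨ cong (λ w → g 0 ℚ.+ (w ℚ.+ ∑ (suc K) h′)) (vandermonde K N i (suc j)) ⟩
    g 0 ℚ.+ (Cℚ-offset (N + K) i (suc j) ℚ.+ ∑ (suc K) h′)
      ≡⟨ solve 3 (λ a b c → a :+ (b :+ c) := (a :+ c) :+ b) refl (g 0) _ (∑ (suc K) h′) ⟩
    (g 0 ℚ.+ ∑ (suc K) h′) ℚ.+ Cℚ-offset (N + K) i (suc j)
      ≡⟨ cong (ℚ._+ Cℚ-offset (N + K) i (suc j)) (sym (∑-unfoldˡ (suc K) (h j))) ⟩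
    ∑ (suc (suc K)) (h j) ℚ.+ Cℚ-offset (N + K) i (suc j)
      ≡⟨ cong (ℚ._+ Cℚ-offset (N + K) i (suc j)) drop-last ⟩
    Cℚ-offset (N + K) i j ℚ.+ Cℚ-offset (N + K) i (suc j)
      ≡⟨ sym (ℕ→ℚ-+ (choose-offset (N + K) i j) (choose-offset (N + K) i (suc j))) ⟩
    ℕ→ℚ (choose-offset (N + K) i j + choose-offset (N + K) i (suc j))
      ≡⟨ cong ℕ→ℚ (sym (choose-offset-pascal (N + K) i j)) ⟩
    Cℚ-offset (suc (N + K)) i j
      ≡⟨ cong (λ w → Cℚ-offset w i j) (sym (+-suc N K)) ⟩
    Cℚ-offset (N + suc K) i j ∎
    where
    open ≡-Reasoning
    open ℚSolver.+-*-Solver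
    g = λ m → Cℚ (suc K) m ℚ.* Cℚ-offset N i (j + m)
    h = λ j′ m → Cℚ K m ℚ.* Cℚ-offset N i (j′ + m)
    h′ = λ m → h j (suc m)
    pascal : ∀ m → Cℚ (suc K) (suc m) ℚ.* Cℚ-offset N i (j + suc m) ≡ h (suc j) m ℚ.+ h′ m
    pascal m = begin
      Cℚ (suc K) (suc m) ℚ.* Cℚ-offset N i (j + suc m)
        ≡⟨ cong (ℚ._* Cℚ-offset N i (j + suc m)) (ℕ→ℚ-+ (choose K m) _) ⟩
      (Cℚ K m ℚ.+ Cℚ K (suc m)) ℚ.* Cℚ-offset N i (j + suc m)
        ≡⟨ ℚP.*-distribʳ-+ _ (Cℚ K m) _ ⟩
      Cℚ K m ℚ.* Cℚ-offset N i (j + suc m) ℚ.+ h′ m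
        ≡⟨ cong (λ w → Cℚ K m ℚ.* Cℚ-offset N i w ℚ.+ h′ m) (+-suc j m) ⟩
      h (suc j) m ℚ.+ h′ m ∎
    drop-last : ∑ (suc (suc K)) (h j) ≡ Cℚ-offset (N + K) i j
    drop-last = begin
      ∑ (suc K) (h j) ℚ.+ Cℚ K (suc K) ℚ.* Cℚ-offset N i (j + suc K)
        ≡⟨ cong (λ w → ∑ (suc K) (h j) ℚ.+ ℕ→ℚ w ℚ.* Cℚ-offset N i (j + suc K)) (choose-> K (suc K) ≤-refl) ⟩
      ∑ (suc K) (h j) ℚ.+ ℚ.0ℚ ℚ.* Cℚ-offset N i (j + suc K)
        ≡⟨ trans (cong (∑ (suc K) (h j) ℚ.+_) (ℚP.*-zeroˡ (Cℚ-offset N i (j + suc K)))) (ℚP.+-identityʳ (∑ (suc K) (h j))) ⟩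
      ∑ (suc K) (h j)
        ≡⟨ vandermonde K N i j ⟩
      Cℚ-offset (N + K) i j ∎

module Polynomials where

  open import Data.Nat as ℕ using (ℕ; zero; suc; z≤n; s≤s)
  import Data.Nat.Properties as ℕP
  open import Data.Bool using (Bool; true; false)
  open import Data.Rational using (ℚ; 0ℚ; 1ℚ; _+_; _*_; _-_; -_)
  open import Data.Rational.Properties
  open import Data.Rational.Solver using (module +-*-Solver)
  open import Data.Product using (Σ-syntax; _×_; _,_)
  open import Relation.Binary.PropositionalEquality
  open import Relation.Nullary using (yes; no)
  open import Defs using (ℕ→ℚ)
  open Rationals
  open BigOperators
  open Binomials
  open +-*-Solver

  -- f agrees on ℕ with a polynomial with m coefficients (degree < m), given in Horner form.
  DegreeBelow : ℕ → (ℕ → ℚ) → Set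
  DegreeBelow zero    f = ∀ s → f s ≡ 0ℚ
  DegreeBelow (suc m) f = Σ[ c ∈ ℚ ] Σ[ g ∈ (ℕ → ℚ) ] DegreeBelow m g × (∀ s → f s ≡ c + ℕ→ℚ s * g s)

  deg<-cong : ∀ m {f g} → DegreeBelow m f → (∀ s → f s ≡ g s) → DegreeBelow m g
  deg<-cong zero    f≡0             f≡g s = trans (sym (f≡g s)) (f≡0 s)
  deg<-cong (suc m) (c , h , H , f≡) f≡g = c , h , H , (λ s → trans (sym (f≡g s)) (f≡ s))

  deg<-zero : ∀ m → DegreeBelow m (λ _ → 0ℚ)
  deg<-zero zero    s = refl
  deg<-zero (suc m) = 0ℚ , (λ _ → 0ℚ) , deg<-zero m , (λ s → sym (trans (+-identityˡ _) (*-zeroʳ (ℕ→ℚ s))))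

  deg<-suc : ∀ m {f} → DegreeBelow m f → DegreeBelow (suc m) f
  deg<-suc zero    f≡0             = 0ℚ , (λ _ → 0ℚ) , (λ _ → refl) , (λ s → trans (f≡0 s) (sym (trans (+-identityˡ _) (*-zeroʳ (ℕ→ℚ s)))))
  deg<-suc (suc m) (c , g , G , f≡) = c , g , deg<-suc m G , f≡

  deg<-mono : ∀ {m n f} → m ℕ.≤ n → DegreeBelow m f → DegreeBelow n f
  deg<-mono {m} {n} m≤n F with m ℕ.≟ n
  ... | yes refl = F
  ... | no m≢n with n | ℕP.≤∧≢⇒< m≤n m≢n
  ...   | suc n′ | s≤s m≤n′ = deg<-suc n′ (deg<-mono m≤n′ F)

  deg<-+ : ∀ m {f g} → DegreeBelow m f → DegreeBelow m g → DegreeBelow m (λ s → f s + g s)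
  deg<-+ zero    F G s = trans (cong₂ _+_ (F s) (G s)) (+-identityˡ 0ℚ)
  deg<-+ (suc m) (c , g , G , f≡) (c′ , g′ , G′ , f′≡) =
    c + c′ , (λ s → g s + g′ s) , deg<-+ m G G′ ,
    (λ s → trans (cong₂ _+_ (f≡ s) (f′≡ s))
                 (solve 5 (λ c c′ x a b → (c :+ x :* a) :+ (c′ :+ x :* b) := (c :+ c′) :+ x :* (a :+ b)) refl c c′ (ℕ→ℚ s) (g s) (g′ s)))

  deg<-scale : ∀ m a {f} → DegreeBelow m f → DegreeBelow m (λ s → a * f s)
  deg<-scale zero    a F s = trans (cong (a *_) (F s)) (*-zeroʳ a)
  deg<-scale (suc m) a (c , g , G , f≡) = a * c , (λ s → a * g s) , deg<-scale m a G ,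
    (λ s → trans (cong (a *_) (f≡ s)) (solve 4 (λ a c x b → a :* (c :+ x :* b) := a :* c :+ x :* (a :* b)) refl a c (ℕ→ℚ s) (g s)))

  deg<-linear : ∀ m a {f} → DegreeBelow m f → DegreeBelow (suc m) (λ s → (ℕ→ℚ s - a) * f s)
  deg<-linear m a {f} F =
    deg<-cong (suc m) (deg<-+ (suc m) {λ s → ℕ→ℚ s * f s} (0ℚ , f , F , (λ s → sym (+-identityˡ (ℕ→ℚ s * f s)))) (deg<-suc m (deg<-scale m (- a) F)))
    (λ s → solve 3 (λ x a b → (x :* b) :+ (:- a) :* b := (x :- a) :* b) refl (ℕ→ℚ s) a (f s))

  deg<-const : ∀ a → DegreeBelow 1 (λ _ → a)
  deg<-const a = a , (λ _ → 0ℚ) , (λ _ → refl) , (λ s → sym (trans (cong (a +_) (*-zeroʳ (ℕ→ℚ s))) (+-identityʳ a)))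

  deg<-∑ : ∀ m n (F : ℕ → ℕ → ℚ) → (∀ t → t ℕ.< n → DegreeBelow m (F t)) → DegreeBelow m (λ s → ∑ n (λ t → F t s))
  deg<-∑ m zero    F _    = deg<-zero m
  deg<-∑ m (suc n) F degF = deg<-+ m (deg<-∑ m n F (λ t t<n → degF t (ℕP.m≤n⇒m≤1+n t<n))) (degF n ℕP.≤-refl)

  factor-theorem : ∀ m {f} → DegreeBelow (suc m) f → ∀ t →
                   Σ[ g ∈ (ℕ → ℚ) ] DegreeBelow m g × (∀ s → f s ≡ f t + (ℕ→ℚ s - ℕ→ℚ t) * g s)
  factor-theorem zero {f} (c , g , g≡0 , f≡) t = (λ _ → 0ℚ) , (λ _ → refl) , f≡′
    where
    f≡′ : ∀ s → f s ≡ f t + (ℕ→ℚ s - ℕ→ℚ t) * 0ℚ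
    f≡′ s = begin
      f s                                    ≡⟨ f≡ s ⟩
      c + ℕ→ℚ s * g s                        ≡⟨ cong₂ (λ a b → c + ℕ→ℚ s * a) (g≡0 s) (g≡0 t) ⟩
      c + ℕ→ℚ s * 0ℚ                         ≡⟨ solve 3 (λ c x y → c :+ x :* con 0ℚ := (c :+ y :* con 0ℚ) :+ (x :- y) :* con 0ℚ) refl c (ℕ→ℚ s) (ℕ→ℚ t) ⟩
      (c + ℕ→ℚ t * 0ℚ) + (ℕ→ℚ s - ℕ→ℚ t) * 0ℚ ≡⟨ cong (λ w → (c + ℕ→ℚ t * w) + (ℕ→ℚ s - ℕ→ℚ t) * 0ℚ) (sym (g≡0 t)) ⟩
      (c + ℕ→ℚ t * g t) + (ℕ→ℚ s - ℕ→ℚ t) * 0ℚ ≡⟨ cong (_+ (ℕ→ℚ s - ℕ→ℚ t) * 0ℚ) (sym (f≡ t)) ⟩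
      f t + (ℕ→ℚ s - ℕ→ℚ t) * 0ℚ             ∎
      where open ≡-Reasoning
  factor-theorem (suc m) {f} (c , g , G , f≡) t with factor-theorem m G t
  ... | h , H , g≡ = (λ s → g s + ℕ→ℚ t * h s) , deg<-+ (suc m) G (deg<-suc m (deg<-scale m (ℕ→ℚ t) H)) , f≡′
    where
    f≡′ : ∀ s → f s ≡ f t + (ℕ→ℚ s - ℕ→ℚ t) * (g s + ℕ→ℚ t * h s)
    f≡′ s = begin
      f s                                                  ≡⟨ f≡ s ⟩
      c + ℕ→ℚ s * g s                                      ≡⟨ cong (λ w → c + ℕ→ℚ s * w) (g≡ s) ⟩
      c + ℕ→ℚ s * (g t + (ℕ→ℚ s - ℕ→ℚ t) * h s)            ≡⟨ solve 5 (λ c x y a b → c :+ x :* (a :+ (x :- y) :* b)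
                                                                  := (c :+ y :* a) :+ (x :- y) :* ((a :+ (x :- y) :* b) :+ y :* b)) refl c (ℕ→ℚ s) (ℕ→ℚ t) (g t) (h s) ⟩
      (c + ℕ→ℚ t * g t) + (ℕ→ℚ s - ℕ→ℚ t) * ((g t + (ℕ→ℚ s - ℕ→ℚ t) * h s) + ℕ→ℚ t * h s)
                                                           ≡⟨ cong₂ (λ a b → a + (ℕ→ℚ s - ℕ→ℚ t) * (b + ℕ→ℚ t * h s)) (sym (f≡ t)) (sym (g≡ s)) ⟩
      f t + (ℕ→ℚ s - ℕ→ℚ t) * (g s + ℕ→ℚ t * h s)          ∎
      where open ≡-Reasoning

  vanishing⇒zero : ∀ n m {f} (p : ℕ → Bool) → DegreeBelow m f → m ℕ.≤ count n p →
                   (∀ l → l ℕ.< n → p l ≡ true → f l ≡ 0ℚ) → ∀ s → f s ≡ 0ℚ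
  vanishing⇒zero zero    zero    p F _   _    s = F s
  vanishing⇒zero (suc n) m       p F m≤c roots s with p n in pn
  vanishing⇒zero (suc n) zero    p F _   _     s | true = F s
  vanishing⇒zero (suc n) (suc m) {f} p F m≤c roots s | true with factor-theorem m F n
  ... | g , G , f≡ = begin
    f s                              ≡⟨ f≡ s ⟩
    f n + (ℕ→ℚ s - ℕ→ℚ n) * g s      ≡⟨ cong₂ (λ a b → a + (ℕ→ℚ s - ℕ→ℚ n) * b) fn≡0 (vanishing⇒zero n m p G (ℕP.≤-pred m≤c) g-roots s) ⟩
    0ℚ + (ℕ→ℚ s - ℕ→ℚ n) * 0ℚ        ≡⟨ trans (+-identityˡ _) (*-zeroʳ (ℕ→ℚ s - ℕ→ℚ n)) ⟩
    0ℚ                               ∎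
    where
    open ≡-Reasoning
    fn≡0 : f n ≡ 0ℚ
    fn≡0 = roots n ℕP.≤-refl pn
    g-roots : ∀ l → l ℕ.< n → p l ≡ true → g l ≡ 0ℚ
    g-roots l l<n pl = *≡0⇒≡0 (ℕ→ℚ l - ℕ→ℚ n) (g l) (ℕ→ℚ-ℕ→ℚ≢0 (ℕP.<⇒≢ l<n)) (begin
      (ℕ→ℚ l - ℕ→ℚ n) * g l        ≡⟨ sym (+-identityˡ _) ⟩
      0ℚ + (ℕ→ℚ l - ℕ→ℚ n) * g l   ≡⟨ cong (_+ (ℕ→ℚ l - ℕ→ℚ n) * g l) (sym fn≡0) ⟩
      f n + (ℕ→ℚ l - ℕ→ℚ n) * g l  ≡⟨ sym (f≡ l) ⟩
      f l                          ≡⟨ roots l (ℕP.m≤n⇒m≤1+n l<n) pl ⟩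
      0ℚ                           ∎)
  vanishing⇒zero (suc n) m p F m≤c roots s | false =
    vanishing⇒zero n m p F m≤c (λ l l<n → roots l (ℕP.m≤n⇒m≤1+n l<n)) s

  deg<-Cℚ : ∀ j → DegreeBelow (suc j) (λ s → Cℚ s j)
  deg<-Cℚ zero    = deg<-const 1ℚ
  deg<-Cℚ (suc j) = deg<-cong (suc (suc j)) (deg<-scale (suc (suc j)) (inv (ℕ→ℚ (suc j))) (deg<-linear (suc j) (ℕ→ℚ j) (deg<-Cℚ j))) eq
    where
    eq : ∀ s → inv (ℕ→ℚ (suc j)) * ((ℕ→ℚ s - ℕ→ℚ j) * Cℚ s j) ≡ Cℚ s (suc j)
    eq s = trans (*-comm (inv (ℕ→ℚ (suc j))) _) (sym (*≡⇒≡*inv (Cℚ s (suc j)) ((ℕ→ℚ s - ℕ→ℚ j) * Cℚ s j) (ℕ→ℚ (suc j)) (ℕ→ℚ-≢0 {suc j} (s≤s z≤n)) (begin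
      Cℚ s (suc j) * ℕ→ℚ (suc j)                                     ≡⟨ solve 3 (λ a b c → a :* b := (b :* a :+ c) :- c) refl (Cℚ s (suc j)) (ℕ→ℚ (suc j)) (ℕ→ℚ j * Cℚ s j) ⟩
      (ℕ→ℚ (suc j) * Cℚ s (suc j) + ℕ→ℚ j * Cℚ s j) - ℕ→ℚ j * Cℚ s j ≡⟨ cong (_- ℕ→ℚ j * Cℚ s j) (sym (Cℚ-shift s j)) ⟩
      ℕ→ℚ s * Cℚ s j - ℕ→ℚ j * Cℚ s j                                ≡⟨ solve 3 (λ a b c → a :* c :- b :* c := (a :- b) :* c) refl (ℕ→ℚ s) (ℕ→ℚ j) (Cℚ s j) ⟩
      (ℕ→ℚ s - ℕ→ℚ j) * Cℚ s j                                       ∎)))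
      where open ≡-Reasoning

  -- Induction on the Horner form; the shift identity Cℚ-shift turns moments of w into moments of i ↦ w i · i.
  moments⇒pairing : ∀ n m (w : ℕ → ℚ) r a → (∀ j → j ℕ.< m → ∑ n (λ i → w i * Cℚ i j) ≡ r * Cℚ a j) →
                    ∀ f → DegreeBelow m f → ∑ n (λ i → w i * f i) ≡ r * f a
  moments⇒pairing n zero    w r a _       f f≡0 =
    trans (∑-zero n (λ i _ → trans (cong (w i *_) (f≡0 i)) (*-zeroʳ (w i)))) (sym (trans (cong (r *_) (f≡0 a)) (*-zeroʳ r)))
  moments⇒pairing n (suc m) w r a moments f (c , g , G , f≡) = begin
    ∑ n (λ i → w i * f i)
      ≡⟨ ∑-cong n (λ i _ → trans (cong (w i *_) (f≡ i)) (solve 4 (λ w c x g → w :* (c :+ x :* g) := c :* (w :* con 1ℚ) :+ (w :* x) :* g) refl (w i) c (ℕ→ℚ i) (g i))) ⟩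
    ∑ n (λ i → c * (w i * Cℚ i 0) + (w i * ℕ→ℚ i) * g i)
      ≡⟨ ∑-distrib-+ n _ _ ⟩
    ∑ n (λ i → c * (w i * Cℚ i 0)) + ∑ n (λ i → (w i * ℕ→ℚ i) * g i)
      ≡⟨ cong₂ _+_ (trans (∑-factorˡ n c _) (cong (c *_) (moments 0 (s≤s z≤n))))
                   (moments⇒pairing n m (λ i → w i * ℕ→ℚ i) (r * ℕ→ℚ a) a shifted-moments g G) ⟩
    c * (r * Cℚ a 0) + (r * ℕ→ℚ a) * g a
      ≡⟨ solve 4 (λ c r x g → c :* (r :* con 1ℚ) :+ (r :* x) :* g := r :* (c :+ x :* g)) refl c r (ℕ→ℚ a) (g a) ⟩
    r * (c + ℕ→ℚ a * g a)
      ≡⟨ cong (r *_) (sym (f≡ a)) ⟩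
    r * f a ∎
    where
    open ≡-Reasoning
    shifted-moments : ∀ j → j ℕ.< m → ∑ n (λ i → (w i * ℕ→ℚ i) * Cℚ i j) ≡ (r * ℕ→ℚ a) * Cℚ a j
    shifted-moments j j<m = begin
      ∑ n (λ i → (w i * ℕ→ℚ i) * Cℚ i j)
        ≡⟨ ∑-cong n (λ i _ → trans (*-assoc (w i) (ℕ→ℚ i) (Cℚ i j)) (cong (w i *_) (Cℚ-shift i j))) ⟩
      ∑ n (λ i → w i * (j+1 * Cℚ i (suc j) + ℕ→ℚ j * Cℚ i j))
        ≡⟨ ∑-cong n (λ i _ → solve 5 (λ w A b B c → w :* (A :* b :+ B :* c) := A :* (w :* b) :+ B :* (w :* c)) refl (w i) j+1 (Cℚ i (suc j)) (ℕ→ℚ j) (Cℚ i j)) ⟩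
      ∑ n (λ i → j+1 * (w i * Cℚ i (suc j)) + ℕ→ℚ j * (w i * Cℚ i j))
        ≡⟨ ∑-distrib-+ n _ _ ⟩
      ∑ n (λ i → j+1 * (w i * Cℚ i (suc j))) + ∑ n (λ i → ℕ→ℚ j * (w i * Cℚ i j))
        ≡⟨ cong₂ _+_ (∑-factorˡ n j+1 _) (∑-factorˡ n (ℕ→ℚ j) _) ⟩
      j+1 * ∑ n (λ i → w i * Cℚ i (suc j)) + ℕ→ℚ j * ∑ n (λ i → w i * Cℚ i j)
        ≡⟨ cong₂ (λ x y → j+1 * x + ℕ→ℚ j * y) (moments (suc j) (s≤s j<m)) (moments j (ℕP.m≤n⇒m≤1+n j<m)) ⟩
      j+1 * (r * Cℚ a (suc j)) + ℕ→ℚ j * (r * Cℚ a j)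
        ≡⟨ solve 5 (λ A l b B c → A :* (l :* b) :+ B :* (l :* c) := l :* (A :* b :+ B :* c)) refl j+1 r (Cℚ a (suc j)) (ℕ→ℚ j) (Cℚ a j) ⟩
      r * (j+1 * Cℚ a (suc j) + ℕ→ℚ j * Cℚ a j)
        ≡⟨ cong (r *_) (sym (Cℚ-shift a j)) ⟩
      r * (ℕ→ℚ a * Cℚ a j)
        ≡⟨ sym (*-assoc r (ℕ→ℚ a) (Cℚ a j)) ⟩
      (r * ℕ→ℚ a) * Cℚ a j ∎
      where j+1 = ℕ→ℚ (suc j)

module Interpolation where

  open import Data.Nat as ℕ using (ℕ; zero; suc)
  import Data.Nat.Properties as ℕP
  open import Data.Bool using (Bool; true; false; if_then_else_)
  open import Data.Rational using (ℚ; 0ℚ; 1ℚ; _+_; _*_; _-_; -_; _≤_; _<_; ∣_∣)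
  open import Data.Rational.Properties
  open import Data.Rational.Solver using (module +-*-Solver)
  open import Function using (_∘_)
  open import Relation.Binary.PropositionalEquality
  open import Defs using (ℕ→ℚ)
  open Rationals
  open BigOperators
  open Polynomials
  open +-*-Solver

  nodePoly : ℕ → (ℕ → Bool) → ℕ → ℚ
  nodePoly n χ s = ∏ n χ (λ l → ℕ→ℚ s - ℕ→ℚ l)

  deg<-nodePoly : ∀ n χ → DegreeBelow (suc (count n χ)) (nodePoly n χ)
  deg<-nodePoly zero    χ = deg<-const 1ℚ
  deg<-nodePoly (suc n) χ with χ n
  ... | true  = deg<-cong (suc (suc (count n χ))) (deg<-linear (suc (count n χ)) (ℕ→ℚ n) (deg<-nodePoly n χ))
                  (λ s → *-comm (ℕ→ℚ s - ℕ→ℚ n) (nodePoly n χ s))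
  ... | false = deg<-nodePoly n χ

  nodePoly-root : ∀ n χ l → l ℕ.< n → χ l ≡ true → nodePoly n χ l ≡ 0ℚ
  nodePoly-root n χ l l<n χl = ∏-zero n χ _ l l<n χl (+-inverseʳ (ℕ→ℚ l))

  nodePoly-≢0 : ∀ n χ s → (∀ l → l ℕ.< n → χ l ≡ true → l ≢ s) → nodePoly n χ s ≢ 0ℚ
  nodePoly-≢0 n χ s off = ∏-≢0 n χ _ (λ l l<n χl → ℕ→ℚ-ℕ→ℚ≢0 (off l l<n χl ∘ sym))

  ∣nodePoly∣ : ∀ n χ s → ∣ nodePoly n χ s ∣ ≡ ∏ n χ (λ l → ℕ→ℚ ℕ.∣ s - l ∣)
  ∣nodePoly∣ n χ s = trans (∣∏∣ n χ _) (∏-cong n (λ _ _ → refl) (λ l _ _ → ∣ℕ→ℚ-ℕ→ℚ∣ s l))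

  basis-self-≢0 : ∀ n χ t → nodePoly n (delete t χ) t ≢ 0ℚ
  basis-self-≢0 n χ t = nodePoly-≢0 n (delete t χ) t (λ l _ → delete-≢ χ)

  lagrange : ℕ → (ℕ → Bool) → ℕ → ℕ → ℚ
  lagrange n χ a t = if χ t then nodePoly n (delete t χ) a * inv (nodePoly n (delete t χ) t) else 0ℚ

  lagrange-off : ∀ n χ a t → χ t ≡ false → lagrange n χ a t ≡ 0ℚ
  lagrange-off n χ a t χt = cong (λ b → if b then nodePoly n (delete t χ) a * inv (nodePoly n (delete t χ) t) else 0ℚ) χt

  lagrange-on : ∀ n χ a t → χ t ≡ true → lagrange n χ a t ≡ nodePoly n (delete t χ) a * inv (nodePoly n (delete t χ) t)
  lagrange-on n χ a t χt = cong (λ b → if b then nodePoly n (delete t χ) a * inv (nodePoly n (delete t χ) t) else 0ℚ) χt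

  deg<-basis : ∀ n χ t → t ℕ.< n → χ t ≡ true → DegreeBelow (count n χ) (nodePoly n (delete t χ))
  deg<-basis n χ t t<n χt = subst (λ m → DegreeBelow m (nodePoly n (delete t χ))) (count-delete n t χ t<n χt) (deg<-nodePoly n (delete t χ))

  basis-other : ∀ n χ t l → l ℕ.< n → χ l ≡ true → l ≢ t → nodePoly n (delete t χ) l ≡ 0ℚ
  basis-other n χ t l l<n χl l≢t = nodePoly-root n (delete t χ) l l<n (trans (delete-other χ l≢t) χl)

  -- The interpolant of f is a polynomial of degree < count n χ agreeing with f on the nodes.
  lagrange-exact : ∀ n χ a f → DegreeBelow (count n χ) f → ∑ n (λ t → lagrange n χ a t * f t) ≡ f a
  lagrange-exact n χ a f F = begin
    L a                         ≡⟨ solve 2 (λ x y → x := (x :+ (:- con 1ℚ) :* y) :+ y) refl (L a) (f a) ⟩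
    (L a + (- 1ℚ) * f a) + f a  ≡⟨ cong (_+ f a) (vanishing⇒zero n (count n χ) χ L-f ℕP.≤-refl L-f-roots a) ⟩
    0ℚ + f a                    ≡⟨ +-identityˡ (f a) ⟩
    f a                         ∎
    where
    open ≡-Reasoning
    L : ℕ → ℚ
    L s = ∑ n (λ t → lagrange n χ s t * f t)
    deg<-term : ∀ t → t ℕ.< n → DegreeBelow (count n χ) (λ s → lagrange n χ s t * f t)
    deg<-term t t<n with χ t in χt
    ... | true  = deg<-cong (count n χ) (deg<-scale (count n χ) (inv (nodePoly n (delete t χ) t) * f t) (deg<-basis n χ t t<n χt))
                    (λ s → solve 3 (λ a b c → (a :* b) :* c := (c :* a) :* b) refl (inv (nodePoly n (delete t χ) t)) (f t) (nodePoly n (delete t χ) s))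
    ... | false = deg<-cong (count n χ) (deg<-zero (count n χ)) (λ s → sym (*-zeroˡ (f t)))
    L-f : DegreeBelow (count n χ) (λ s → L s + (- 1ℚ) * f s)
    L-f = deg<-+ (count n χ) (deg<-∑ (count n χ) n (λ t s → lagrange n χ s t * f t) deg<-term) (deg<-scale (count n χ) (- 1ℚ) F)
    L-at-node : ∀ l → l ℕ.< n → χ l ≡ true → L l ≡ f l
    L-at-node l l<n χl = trans (∑-single n l l<n others) self
      where
      others : ∀ t → t ℕ.< n → t ≢ l → lagrange n χ l t * f t ≡ 0ℚ
      others t _ t≢l with χ t
      ... | true  = trans (cong (λ w → (w * inv (nodePoly n (delete t χ) t)) * f t) (basis-other n χ t l l<n χl (t≢l ∘ sym)))
                          (trans (cong (_* f t) (*-zeroˡ (inv (nodePoly n (delete t χ) t)))) (*-zeroˡ (f t)))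
      ... | false = *-zeroˡ (f t)
      self : lagrange n χ l l * f l ≡ f l
      self = trans (cong (_* f l) (trans (lagrange-on n χ l l χl) (*-invʳ _ (basis-self-≢0 n χ l)))) (*-identityˡ (f l))
    L-f-roots : ∀ l → l ℕ.< n → χ l ≡ true → L l + (- 1ℚ) * f l ≡ 0ℚ
    L-f-roots l l<n χl = trans (cong (_+ (- 1ℚ) * f l) (L-at-node l l<n χl))
                               (solve 1 (λ x → x :+ (:- con 1ℚ) :* x := con 0ℚ) refl (f l))

  lagrange-unique : ∀ n χ (u : ℕ → ℚ) a → (∀ i → χ i ≡ false → u i ≡ 0ℚ) →
                    (∀ f → DegreeBelow (count n χ) f → ∑ n (λ i → u i * f i) ≡ f a) →
                    ∀ t → t ℕ.< n → χ t ≡ true → u t ≡ lagrange n χ a t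
  lagrange-unique n χ u a supported reproduces t t<n χt = trans
    (*≡⇒≡*inv (u t) (ℓ a) (ℓ t) (basis-self-≢0 n χ t)
      (trans (sym (∑-single n t t<n others)) (reproduces ℓ (deg<-basis n χ t t<n χt))))
    (sym (lagrange-on n χ a t χt))
    where
    ℓ = nodePoly n (delete t χ)
    others : ∀ i → i ℕ.< n → i ≢ t → u i * ℓ i ≡ 0ℚ
    others i i<n i≢t with χ i in χi
    ... | true  = trans (cong (u i *_) (basis-other n χ t i i<n χi i≢t)) (*-zeroʳ (u i))
    ... | false = trans (cong (_* ℓ i) (supported i χi)) (*-zeroˡ (ℓ i))

  -- Every factor (b - l) / (t - l) of the weight is positive.
  lagrange-greatest-pos : ∀ n χ b t → n ℕ.≤ b → χ t ≡ true → (∀ l → l ℕ.< n → χ l ≡ true → l ℕ.≤ t) →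
                          0ℚ < lagrange n χ b t
  lagrange-greatest-pos n χ b t n≤b χt greatest = subst (0ℚ <_) (sym (lagrange-on n χ b t χt))
    (0<*0< (∏-pos n (delete t χ) _ (λ l l<n _ → sub-pos (ℕP.<-≤-trans l<n n≤b)))
           (inv-pos _ (∏-pos n (delete t χ) _ (λ l l<n dl → sub-pos (ℕP.≤∧≢⇒< (greatest l l<n (delete-⊆ χ dl)) (delete-≢ χ dl))))))
    where
    sub-pos : ∀ {l s} → l ℕ.< s → 0ℚ < ℕ→ℚ s - ℕ→ℚ l
    sub-pos {l} {s} l<s = subst (0ℚ <_) (ℕ→ℚ-∸ s l (ℕP.<⇒≤ l<s)) (ℕ→ℚ-mono-< (ℕP.m<n⇒0<n∸m l<s))

  -- Replacing the node e by e′ multiplies the weight of every other node t by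
  -- (|a - e′| / |a - e|) · (|t - e| / |t - e′|), and the moved weight is |P(a)| / |P(e′)| instead of
  -- |P(a)| / |P(e)|, where P is the node polynomial of the remaining nodes.
  module Exchange (n : ℕ) (χ : ℕ → Bool) (a e e′ : ℕ) (n≤a : n ℕ.≤ a) (e<n : e ℕ.< n) (e′<n : e′ ℕ.< n)
                  (χe : χ e ≡ true) (χe′ : χ e′ ≡ false) where

    S χ′ : ℕ → Bool
    S  = delete e χ
    χ′ = insert e′ S

    private
      e′≢e : e′ ≢ e
      e′≢e = true≢false-at {e} {e′} χ χe χe′ ∘ sym

      Se′ : S e′ ≡ false
      Se′ = trans (delete-other χ e′≢e) χe′

      S⇒≢e′ : ∀ {t} → S t ≡ true → t ≢ e′
      S⇒≢e′ {t} St = true≢false-at {t} {e′} S St Se′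

      a-off-nodes : ∀ l → l ℕ.< n → S l ≡ true → l ≢ a
      a-off-nodes l l<n _ refl = ℕP.<-irrefl refl (ℕP.<-≤-trans l<n n≤a)

      dist : ℕ → ℕ → ℚ
      dist s l = ℕ→ℚ ℕ.∣ s - l ∣

      Q : ℕ → ℕ → ℚ
      Q t = nodePoly n (delete t S)

      basis-split : ∀ p c t s → c ℕ.< n → delete t S c ≡ false → (∀ l → delete t p l ≡ insert c (delete t S) l) →
                    ∣ nodePoly n (delete t p) s ∣ ≡ dist s c * ∣ Q t s ∣
      basis-split p c t s c<n c∉ pointwise = begin
        ∣ nodePoly n (delete t p) s ∣            ≡⟨ cong ∣_∣ (∏-cong n (λ l _ → pointwise l) (λ _ _ _ → refl)) ⟩
        ∣ nodePoly n (insert c (delete t S)) s ∣ ≡⟨ cong ∣_∣ (∏-insert n (delete t S) _ c c<n c∉) ⟩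
        ∣ (ℕ→ℚ s - ℕ→ℚ c) * Q t s ∣              ≡⟨ ∣p*q∣≡∣p∣*∣q∣ (ℕ→ℚ s - ℕ→ℚ c) (Q t s) ⟩
        ∣ ℕ→ℚ s - ℕ→ℚ c ∣ * ∣ Q t s ∣            ≡⟨ cong (_* ∣ Q t s ∣) (∣ℕ→ℚ-ℕ→ℚ∣ s c) ⟩
        dist s c * ∣ Q t s ∣                     ∎
        where open ≡-Reasoning

      ∣basis-χ∣ : ∀ t s → S t ≡ true → ∣ nodePoly n (delete t χ) s ∣ ≡ dist s e * ∣ Q t s ∣
      ∣basis-χ∣ t s St = basis-split χ e t s e<n (delete-∉ t S (delete-self e χ))
        (λ l → trans (delete-cong t {p = χ} {q = insert e S} (sym (insert-delete χ l χe))) (delete-insert S l (delete-≢ χ St)))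

      ∣basis-χ′∣ : ∀ t s → S t ≡ true → ∣ nodePoly n (delete t χ′) s ∣ ≡ dist s e′ * ∣ Q t s ∣
      ∣basis-χ′∣ t s St = basis-split χ′ e′ t s e′<n (delete-∉ t S Se′) (λ l → delete-insert S l (S⇒≢e′ St))

      ∣lagrange∣ : ∀ p t → p t ≡ true → ∣ lagrange n p a t ∣ ≡ ∣ nodePoly n (delete t p) a ∣ * inv ∣ nodePoly n (delete t p) t ∣
      ∣lagrange∣ p t pt = trans (cong ∣_∣ (lagrange-on n p a t pt)) (∣*inv∣ (nodePoly n (delete t p) a) (nodePoly n (delete t p) t))

      dist-pos : ∀ {s l} → s ≢ l → 0ℚ < dist s l
      dist-pos {s} {l} s≢l = subst (0ℚ <_) (∣ℕ→ℚ-ℕ→ℚ∣ s l) (≢0⇒∣∣-pos _ (ℕ→ℚ-ℕ→ℚ≢0 s≢l))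

      stays-smaller : ∀ t → S t ≡ true → ℕ.∣ a - e′ ∣ ℕ.* ℕ.∣ t - e ∣ ℕ.≤ ℕ.∣ a - e ∣ ℕ.* ℕ.∣ t - e′ ∣ →
                      ∣ lagrange n χ′ a t ∣ ≤ ∣ lagrange n χ a t ∣
      stays-smaller t St ratio = subst₂ _≤_
        (sym (trans (∣lagrange∣ χ′ t (trans (insert-other S (S⇒≢e′ St)) St)) (cong₂ (λ x y → x * inv y) (∣basis-χ′∣ t a St) (∣basis-χ′∣ t t St))))
        (sym (trans (∣lagrange∣ χ t (delete-⊆ χ St)) (cong₂ (λ x y → x * inv y) (∣basis-χ∣ t a St) (∣basis-χ∣ t t St))))
        (*inv-mono-≤ (dist a e′ * ∣ Q t a ∣) (dist a e * ∣ Q t a ∣) (dist t e′ * ∣ Q t t ∣) (dist t e * ∣ Q t t ∣) (0<*0< (dist-pos (S⇒≢e′ St)) ∣Qtt∣-pos) (0<*0< (dist-pos (delete-≢ χ St)) ∣Qtt∣-pos) cross)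
        where
        ∣Qtt∣-pos : 0ℚ < ∣ Q t t ∣
        ∣Qtt∣-pos = ≢0⇒∣∣-pos _ (basis-self-≢0 n S t)
        regroup : ∀ w x y z → (w * y) * (x * z) ≡ (w * x) * (y * z)
        regroup = solve 4 (λ w x y z → (w :* y) :* (x :* z) := (w :* x) :* (y :* z)) refl
        cross : (dist a e′ * ∣ Q t a ∣) * (dist t e * ∣ Q t t ∣) ≤ (dist a e * ∣ Q t a ∣) * (dist t e′ * ∣ Q t t ∣)
        cross = subst₂ _≤_
          (trans (cong (_* (∣ Q t a ∣ * ∣ Q t t ∣)) (ℕ→ℚ-* ℕ.∣ a - e′ ∣ ℕ.∣ t - e ∣)) (sym (regroup (dist a e′) (dist t e) (∣ Q t a ∣) (∣ Q t t ∣))))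
          (trans (cong (_* (∣ Q t a ∣ * ∣ Q t t ∣)) (ℕ→ℚ-* ℕ.∣ a - e ∣ ℕ.∣ t - e′ ∣)) (sym (regroup (dist a e) (dist t e′) (∣ Q t a ∣) (∣ Q t t ∣))))
          (*-monoʳ-≤-0≤ (∣ Q t a ∣ * ∣ Q t t ∣) (0≤*0≤ (0≤∣p∣ (Q t a)) (0≤∣p∣ (Q t t))) (ℕ→ℚ-mono-≤ ratio))

      gets-smaller : 0 ℕ.< count n S → (∀ t → t ℕ.< n → S t ≡ true → ℕ.∣ e - t ∣ ℕ.< ℕ.∣ e′ - t ∣) →
                     ∣ lagrange n χ′ a e′ ∣ < ∣ lagrange n χ a e ∣
      gets-smaller nonempty farther = subst₂ _<_
        (sym (trans (∣lagrange∣ χ′ e′ (insert-self e′ S))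
                    (cong₂ (λ x y → ∣ x ∣ * inv ∣ y ∣) (∏-cong n (λ l _ → delete-insert-self S l Se′) (λ _ _ _ → refl))
                                                       (∏-cong n (λ l _ → delete-insert-self S l Se′) (λ _ _ _ → refl)))))
        (sym (∣lagrange∣ χ e χe))
        (*inv-antimono-< (∣ nodePoly n S a ∣) (∣ nodePoly n S e ∣) (∣ nodePoly n S e′ ∣) (≢0⇒∣∣-pos _ (nodePoly-≢0 n S a a-off-nodes)) (≢0⇒∣∣-pos _ (basis-self-≢0 n χ e)) closer)
        where
        closer : ∣ nodePoly n S e ∣ < ∣ nodePoly n S e′ ∣
        closer = subst₂ _<_ (sym (∣nodePoly∣ n S e)) (sym (∣nodePoly∣ n S e′))
          (∏-mono-< n S _ _ (λ l _ Sl → dist-pos (delete-≢ χ Sl ∘ sym)) (λ l l<n Sl → ℕ→ℚ-mono-< (farther l l<n Sl)) nonempty)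

    lagrange-exchange : 0 ℕ.< count n S →
                        (∀ t → t ℕ.< n → S t ≡ true → ℕ.∣ e - t ∣ ℕ.< ℕ.∣ e′ - t ∣) →
                        (∀ t → t ℕ.< n → S t ≡ true → ℕ.∣ a - e′ ∣ ℕ.* ℕ.∣ t - e ∣ ℕ.≤ ℕ.∣ a - e ∣ ℕ.* ℕ.∣ t - e′ ∣) →
                        ∑ n (λ t → ∣ lagrange n χ′ a t ∣) < ∑ n (λ t → ∣ lagrange n χ a t ∣)
    lagrange-exchange nonempty farther ratio = subst₂ _<_
      (sym (∑-split-single n S (λ t → ∣ lagrange n χ′ a t ∣) e′ e′<n Se′ (λ i _ i≢e′ Si → cong ∣_∣ (lagrange-off n χ′ a i (trans (insert-other S i≢e′) Si)))))
      (sym (∑-split-single n S (λ t → ∣ lagrange n χ a t ∣) e e<n (delete-self e χ) (λ i _ i≢e Si → cong ∣_∣ (lagrange-off n χ a i (trans (sym (delete-other χ i≢e)) Si)))))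
      (+-mono-≤-< (∑-mono-≤ n termwise) (gets-smaller nonempty farther))
      where
      termwise : ∀ t → t ℕ.< n → (if S t then ∣ lagrange n χ′ a t ∣ else 0ℚ) ≤ (if S t then ∣ lagrange n χ a t ∣ else 0ℚ)
      termwise t t<n = by-cases (S t) refl
        where
        by-cases : ∀ b → S t ≡ b → (if b then ∣ lagrange n χ′ a t ∣ else 0ℚ) ≤ (if b then ∣ lagrange n χ a t ∣ else 0ℚ)
        by-cases true  St = stays-smaller t St (ratio t t<n St)
        by-cases false _  = ≤-refl

module LinearProgram where

  open import Data.Nat as ℕ using (ℕ; zero; suc; s≤s; _∸_)
  import Data.Nat.Properties as ℕP
  open import Data.Bool using (if_then_else_)
  open import Data.Fin.Subset using (_∉_)
  open import Data.Empty using (⊥-elim)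
  open import Data.Rational using (ℚ; 0ℚ; 1ℚ; ½; _+_; _*_; _-_; -_; _≤_; _<_; ∣_∣)
  open import Data.Rational.Properties
  open import Data.Rational.Solver using (module +-*-Solver)
  open import Data.Fin as Fin using (Fin; toℕ)
  import Data.Fin.Properties as FinP
  open import Function using (_∘_)
  open import Data.Nat.Induction using (<-rec)
  open import Relation.Binary.PropositionalEquality
  open import Relation.Nullary using (yes; no)
  open import Data.Product using (Σ-syntax; _×_; _,_; proj₁; proj₂)
  open import Defs
  open Rationals
  open BigOperators
  open Binomials
  open Polynomials
  open +-*-Solver

  extend : ∀ {n} → (Fin n → ℚ) → ℕ → ℚ
  extend {zero}  v j       = 0ℚ
  extend {suc n} v zero    = v Fin.zero
  extend {suc n} v (suc j) = extend (v ∘ Fin.suc) j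

  extend-toℕ : ∀ {n} (v : Fin n → ℚ) i → extend v (toℕ i) ≡ v i
  extend-toℕ v Fin.zero    = refl
  extend-toℕ v (Fin.suc i) = extend-toℕ (v ∘ Fin.suc) i

  extend-≥ : ∀ {n} (v : Fin n → ℚ) j → n ℕ.≤ j → extend v j ≡ 0ℚ
  extend-≥ {zero}  v j       _         = refl
  extend-≥ {suc n} v (suc j) (s≤s n≤j) = extend-≥ (v ∘ Fin.suc) j n≤j

  extend-tabulate : ∀ {n} (g : ℕ → ℚ) j → j ℕ.< n → extend {n} (g ∘ toℕ) j ≡ g j
  extend-tabulate {suc n} g zero    _         = refl
  extend-tabulate {suc n} g (suc j) (s≤s j<n) = extend-tabulate (g ∘ suc) j j<n

  extend-tabulate-all : ∀ {n} (g : ℕ → ℚ) → (∀ j → n ℕ.≤ j → g j ≡ 0ℚ) → ∀ j → extend {n} (g ∘ toℕ) j ≡ g j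
  extend-tabulate-all {n} g g-high j with j ℕ.<? n
  ... | yes j<n = extend-tabulate g j j<n
  ... | no j≮n = trans (extend-≥ (g ∘ toℕ) j (ℕP.≮⇒≥ j≮n)) (sym (g-high j (ℕP.≮⇒≥ j≮n)))

  extend-zero : ∀ {n} (v : Fin n → ℚ) → (∀ i → v i ≡ 0ℚ) → ∀ j → extend v j ≡ 0ℚ
  extend-zero {zero}  v v≡0 j       = refl
  extend-zero {suc n} v v≡0 zero    = v≡0 Fin.zero
  extend-zero {suc n} v v≡0 (suc j) = extend-zero (v ∘ Fin.suc) (v≡0 ∘ Fin.suc) j

  extend-nonneg : ∀ {n} (v : Fin n → ℚ) → (∀ i → 0ℚ ≤ v i) → ∀ j → 0ℚ ≤ extend v j
  extend-nonneg {zero}  v v≥0 j       = ≤-refl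
  extend-nonneg {suc n} v v≥0 zero    = v≥0 Fin.zero
  extend-nonneg {suc n} v v≥0 (suc j) = extend-nonneg (v ∘ Fin.suc) (v≥0 ∘ Fin.suc) j

  Σℚ≡∑ : ∀ {n} (v : Fin n → ℚ) (g : ℕ → ℚ) → (∀ i → v i ≡ g (toℕ i)) → Σℚ v ≡ ∑ n g
  Σℚ≡∑ {zero}  v g eq = refl
  Σℚ≡∑ {suc n} v g eq = trans (cong₂ _+_ (eq Fin.zero) (Σℚ≡∑ (v ∘ Fin.suc) (g ∘ suc) (eq ∘ Fin.suc))) (sym (∑-unfoldˡ n g))

  δ : ℕ → ℕ → ℚ
  δ k h = if h ℕ.≡ᵇ k then 1ℚ else 0ℚ

  δ-refl : ∀ k → δ k k ≡ 1ℚ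
  δ-refl zero    = refl
  δ-refl (suc k) = δ-refl k

  δ-≢ : ∀ {k h} → h ≢ k → δ k h ≡ 0ℚ
  δ-≢ {zero}  {zero}  h≢k = ⊥-elim (h≢k refl)
  δ-≢ {zero}  {suc h} _   = refl
  δ-≢ {suc k} {zero}  _   = refl
  δ-≢ {suc k} {suc h} h≢k = δ-≢ {k} {h} (h≢k ∘ cong suc)

  module Constraints (ν d k : ℕ) (d<ν : d ℕ.< ν) (k≤d : k ℕ.≤ d) where

    N : ℕ
    N = ν ∸ k

    k≤ν : k ℕ.≤ ν
    k≤ν = ℕP.≤-trans k≤d (ℕP.<⇒≤ d<ν)

    net : (Fin ν → ℚ) → (Fin (suc d) → ℚ) → ℕ → ℚ
    net y x i = extend x i - extend y i

    row : (ℕ → ℚ) → ℕ → ℚ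
    row z h = ∑ ν (λ i → Cℚ-offset N i h * z i)

    lhs≡row : ∀ y x (h : Fin (suc k)) → lhs ν d k y x h ≡ row (net y x) (toℕ h)
    lhs≡row y x h = begin
      lhs ν d k y x h
        ≡⟨ cong₂ _-_ (Σℚ≡∑ _ (λ i → c i * extend x i) (λ i → cong₂ _*_ (cong ℕ→ℚ (binom≡choose-offset N (toℕ i) (toℕ h))) (sym (extend-toℕ x i))))
                     (Σℚ≡∑ _ (λ i → c i * extend y i) (λ i → cong₂ _*_ (cong ℕ→ℚ (binom≡choose-offset N (toℕ i) (toℕ h))) (sym (extend-toℕ y i)))) ⟩
      ∑ (suc d) (λ i → c i * extend x i) - ∑ ν (λ i → c i * extend y i)
        ≡⟨ cong (_- ∑ ν (λ i → c i * extend y i)) (∑-extend (suc d) ν _ d<ν (λ i 1+d≤i _ → trans (cong (c i *_) (extend-≥ x i 1+d≤i)) (*-zeroʳ (c i)))) ⟩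
      ∑ ν (λ i → c i * extend x i) - ∑ ν (λ i → c i * extend y i)
        ≡⟨ sym (∑-distrib-- ν _ _) ⟩
      ∑ ν (λ i → c i * extend x i - c i * extend y i)
        ≡⟨ ∑-cong ν (λ i _ → solve 3 (λ a b c → a :* b :- a :* c := a :* (b :- c)) refl (c i) (extend x i) (extend y i)) ⟩
      row (net y x) (toℕ h) ∎
      where
      open ≡-Reasoning
      c = λ i → Cℚ-offset N i (toℕ h)

    weighted : (ℕ → ℚ) → ℕ → ℚ
    weighted z i = Cℚ ν i * z i

    moment : (ℕ → ℚ) → ℕ → ℚ
    moment u j = ∑ ν (λ i → u i * Cℚ i j)

    rowSum : (ℕ → ℚ) → ℕ → ℚ
    rowSum z j = ∑ (suc (k ∸ j)) (λ m → Cℚ (k ∸ j) m * row z (j ℕ.+ m))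

    -- C(ν, i) C(i, j) = C(ν, j) C(ν - j, i - j), and Vandermonde splits C(ν - j, ·) along ν - j = N + (k - j).
    moment≡rowSum : ∀ z j → j ℕ.≤ k → moment (weighted z) j ≡ Cℚ ν j * rowSum z j
    moment≡rowSum z j j≤k = sym (begin
      Cℚ ν j * ∑ (suc K) (λ m → Cℚ K m * ∑ ν (λ i → Cℚ-offset N i (j ℕ.+ m) * z i))
        ≡⟨ sym (∑-factorˡ (suc K) (Cℚ ν j) _) ⟩
      ∑ (suc K) (λ m → Cℚ ν j * (Cℚ K m * ∑ ν (λ i → Cℚ-offset N i (j ℕ.+ m) * z i)))
        ≡⟨ ∑-cong (suc K) (λ m _ → trans (cong (Cℚ ν j *_) (sym (∑-factorˡ ν (Cℚ K m) _))) (sym (∑-factorˡ ν (Cℚ ν j) _))) ⟩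
      ∑ (suc K) (λ m → ∑ ν (λ i → Cℚ ν j * (Cℚ K m * (Cℚ-offset N i (j ℕ.+ m) * z i))))
        ≡⟨ ∑-comm (suc K) ν _ ⟩
      ∑ ν (λ i → ∑ (suc K) (λ m → Cℚ ν j * (Cℚ K m * (Cℚ-offset N i (j ℕ.+ m) * z i))))
        ≡⟨ ∑-cong ν (λ i _ → per-index i) ⟩
      moment (weighted z) j ∎)
      where
      open ≡-Reasoning
      K = k ∸ j
      N+K≡ν∸j : N ℕ.+ K ≡ ν ∸ j
      N+K≡ν∸j = trans (sym (ℕP.+-∸-assoc (ν ∸ k) j≤k)) (cong (_∸ j) (ℕP.m∸n+n≡m k≤ν))
      per-index : ∀ i → ∑ (suc K) (λ m → Cℚ ν j * (Cℚ K m * (Cℚ-offset N i (j ℕ.+ m) * z i))) ≡ weighted z i * Cℚ i j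
      per-index i = begin
        ∑ (suc K) (λ m → Cℚ ν j * (Cℚ K m * (Cℚ-offset N i (j ℕ.+ m) * z i)))
          ≡⟨ ∑-cong (suc K) (λ m _ → solve 4 (λ c a b z → c :* (a :* (b :* z)) := (c :* (a :* b)) :* z) refl (Cℚ ν j) (Cℚ K m) (Cℚ-offset N i (j ℕ.+ m)) (z i)) ⟩
        ∑ (suc K) (λ m → (Cℚ ν j * (Cℚ K m * Cℚ-offset N i (j ℕ.+ m))) * z i)
          ≡⟨ trans (∑-factorʳ (suc K) (z i) _) (cong (_* z i) (∑-factorˡ (suc K) (Cℚ ν j) _)) ⟩
        Cℚ ν j * ∑ (suc K) (λ m → Cℚ K m * Cℚ-offset N i (j ℕ.+ m)) * z i
          ≡⟨ cong (λ w → Cℚ ν j * w * z i) (vandermonde K N i j) ⟩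
        Cℚ ν j * Cℚ-offset (N ℕ.+ K) i j * z i
          ≡⟨ cong (λ w → Cℚ ν j * Cℚ-offset w i j * z i) N+K≡ν∸j ⟩
        Cℚ ν j * Cℚ-offset (ν ∸ j) i j * z i
          ≡⟨ cong (_* z i) (sym (ℕ→ℚ-* (choose ν j) _)) ⟩
        ℕ→ℚ (choose ν j ℕ.* choose-offset (ν ∸ j) i j) * z i
          ≡⟨ cong (λ w → ℕ→ℚ w * z i) (sym (choose-subset ν i j)) ⟩
        ℕ→ℚ (choose ν i ℕ.* choose i j) * z i
          ≡⟨ cong (_* z i) (ℕ→ℚ-* (choose ν i) (choose i j)) ⟩
        Cℚ ν i * Cℚ i j * z i
          ≡⟨ solve 3 (λ c x z → c :* x :* z := (c :* z) :* x) refl (Cℚ ν i) (Cℚ i j) (z i) ⟩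
        weighted z i * Cℚ i j ∎

    private
      rowSum-unfold : ∀ z h K → h ℕ.+ K ≡ k → rowSum z h ≡ ∑ (suc K) (λ m → Cℚ K m * row z (h ℕ.+ m))
      rowSum-unfold z h K h+K≡k = cong (λ K → ∑ (suc K) (λ m → Cℚ K m * row z (h ℕ.+ m))) (trans (cong (_∸ h) (sym h+K≡k)) (ℕP.m+n∸m≡n h K))

      row-last : ∀ z h → h ≡ k → rowSum z h ≡ row z h
      row-last z h h≡k = begin
        rowSum z h                                   ≡⟨ rowSum-unfold z h 0 (trans (ℕP.+-identityʳ h) h≡k) ⟩
        0ℚ + 1ℚ * row z (h ℕ.+ 0)                    ≡⟨ trans (+-identityˡ _) (*-identityˡ _) ⟩
        row z (h ℕ.+ 0)                              ≡⟨ cong (row z) (ℕP.+-identityʳ h) ⟩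
        row z h                                      ∎
        where open ≡-Reasoning

    rows⇒rowSum≡1 : ∀ z → (∀ h → h ℕ.≤ k → row z h ≡ δ k h) → ∀ j → j ℕ.≤ k → rowSum z j ≡ 1ℚ
    rows⇒rowSum≡1 z rows j j≤k = begin
      rowSum z j                          ≡⟨ rowSum-unfold z j K j+K≡k ⟩
      ∑ (suc K) (λ m → Cℚ K m * row z (j ℕ.+ m)) ≡⟨ ∑-single (suc K) K ℕP.≤-refl off-diagonal ⟩
      Cℚ K K * row z (j ℕ.+ K)            ≡⟨ cong₂ (λ c w → ℕ→ℚ c * w) (choose-n-n K) (trans (cong (row z) j+K≡k) (trans (rows k ℕP.≤-refl) (δ-refl k))) ⟩
      1ℚ * 1ℚ                             ≡⟨ *-identityˡ 1ℚ ⟩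
      1ℚ                                  ∎
      where
      open ≡-Reasoning
      K = k ∸ j
      j+K≡k : j ℕ.+ K ≡ k
      j+K≡k = ℕP.m+[n∸m]≡n j≤k
      off-diagonal : ∀ m → m ℕ.< suc K → m ≢ K → Cℚ K m * row z (j ℕ.+ m) ≡ 0ℚ
      off-diagonal m m<1+K m≢K = trans
        (cong (Cℚ K m *_) (trans (rows (j ℕ.+ m) (subst (j ℕ.+ m ℕ.≤_) j+K≡k (ℕP.+-monoʳ-≤ j (ℕP.≤-pred m<1+K))))
                                 (δ-≢ (λ e → m≢K (ℕP.+-cancelˡ-≡ j m K (trans e (sym j+K≡k)))))))
        (*-zeroʳ (Cℚ K m))

    -- Inverting the triangular system rowSum z = r, from the last row upwards.
    rowSum≡⇒rows : ∀ z r → (∀ j → j ℕ.≤ k → rowSum z j ≡ r) → ∀ h → h ℕ.≤ k → row z h ≡ r * δ k h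
    rowSum≡⇒rows z r rowSums h h≤k = <-rec P step (k ∸ h) h (ℕP.m+[n∸m]≡n h≤k)
      where
      open ≡-Reasoning
      P : ℕ → Set
      P K = ∀ h → h ℕ.+ K ≡ k → row z h ≡ r * δ k h
      step : ∀ K → (∀ {K′} → K′ ℕ.< K → P K′) → P K
      step zero    _  h h+0≡k = begin
        row z h          ≡⟨ sym (row-last z h h≡k) ⟩
        rowSum z h       ≡⟨ rowSums h (ℕP.≤-reflexive h≡k) ⟩
        r                ≡⟨ sym (*-identityʳ r) ⟩
        r * 1ℚ           ≡⟨ cong (r *_) (sym (trans (cong (δ k) h≡k) (δ-refl k))) ⟩
        r * δ k h        ∎
        where h≡k = trans (sym (ℕP.+-identityʳ h)) h+0≡k
      step (suc K) IH h h+1+K≡k = begin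
        row z h                   ≡⟨ solve 2 (λ a b → a := (a :+ b) :- b) refl (row z h) r ⟩
        (row z h + r) - r         ≡⟨ cong (_- r) row+r≡r ⟩
        r - r                     ≡⟨ +-inverseʳ r ⟩
        0ℚ                        ≡⟨ sym (*-zeroʳ r) ⟩
        r * 0ℚ                    ≡⟨ cong (r *_) (sym (δ-≢ h≢k)) ⟩
        r * δ k h                 ∎
        where
        h≢k : h ≢ k
        h≢k h≡k = ℕP.m+1+n≢m h (trans h+1+K≡k (sym h≡k))
        g = λ m → Cℚ (suc K) m * row z (h ℕ.+ m)
        later : ∀ m → m ℕ.< suc K → m ≢ K → g (suc m) ≡ 0ℚ
        later m m<1+K m≢K = trans
          (cong (Cℚ (suc K) (suc m) *_) (trans (IH (s≤s (ℕP.m∸n≤m K m)) (h ℕ.+ suc m) h+1+m+[K∸m]≡k)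
            (trans (cong (r *_) (δ-≢ (λ e → m≢K (ℕP.suc-injective (ℕP.+-cancelˡ-≡ h (suc m) (suc K) (trans e (sym h+1+K≡k))))))) (*-zeroʳ r))))
          (*-zeroʳ (Cℚ (suc K) (suc m)))
          where
          h+1+m+[K∸m]≡k : h ℕ.+ suc m ℕ.+ (K ∸ m) ≡ k
          h+1+m+[K∸m]≡k = trans (ℕP.+-assoc h (suc m) (K ∸ m)) (trans (cong (λ w → h ℕ.+ suc w) (ℕP.m+[n∸m]≡n (ℕP.≤-pred m<1+K))) h+1+K≡k)
        tail≡r : ∑ (suc K) (g ∘ suc) ≡ r
        tail≡r = begin
          ∑ (suc K) (g ∘ suc)                      ≡⟨ ∑-single (suc K) K ℕP.≤-refl later ⟩
          Cℚ (suc K) (suc K) * row z (h ℕ.+ suc K) ≡⟨ cong₂ (λ c w → ℕ→ℚ c * row z w) (choose-n-n (suc K)) h+1+K≡k ⟩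
          1ℚ * row z k                             ≡⟨ *-identityˡ (row z k) ⟩
          row z k                                  ≡⟨ sym (row-last z k refl) ⟩
          rowSum z k                               ≡⟨ rowSums k ℕP.≤-refl ⟩
          r                                        ∎
        row+r≡r : row z h + r ≡ r
        row+r≡r = begin
          row z h + r                     ≡⟨ cong₂ _+_ (sym (trans (*-identityˡ _) (cong (row z) (ℕP.+-identityʳ h)))) (sym tail≡r) ⟩
          g 0 + ∑ (suc K) (g ∘ suc)       ≡⟨ sym (∑-unfoldˡ (suc K) g) ⟩
          ∑ (suc (suc K)) g               ≡⟨ sym (rowSum-unfold z h (suc K) h+1+K≡k) ⟩
          rowSum z h                      ≡⟨ rowSums h (ℕP.≤-trans (ℕP.m≤m+n h (suc K)) (ℕP.≤-reflexive h+1+K≡k)) ⟩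
          r                               ∎

    Cℚ-ν-pos : ∀ i → i ℕ.≤ ν → 0ℚ < Cℚ ν i
    Cℚ-ν-pos i i≤ν = ℕ→ℚ-mono-< (choose-pos ν i i≤ν)

    Cℚ-ν-≢0 : ∀ i → i ℕ.≤ ν → Cℚ ν i ≢ 0ℚ
    Cℚ-ν-≢0 i i≤ν eq = <-irrefl (sym eq) (Cℚ-ν-pos i i≤ν)

    rows⇒pairing : ∀ z → (∀ h → h ℕ.≤ k → row z h ≡ δ k h) →
                   ∀ f → DegreeBelow (suc k) f → ∑ ν (λ i → weighted z i * f i) ≡ f ν
    rows⇒pairing z rows f F = trans (moments⇒pairing ν (suc k) (weighted z) 1ℚ ν moments f F) (*-identityˡ (f ν))
      where
      moments : ∀ j → j ℕ.< suc k → moment (weighted z) j ≡ 1ℚ * Cℚ ν j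
      moments j j<1+k = begin
        moment (weighted z) j    ≡⟨ moment≡rowSum z j (ℕP.≤-pred j<1+k) ⟩
        Cℚ ν j * rowSum z j      ≡⟨ cong (Cℚ ν j *_) (rows⇒rowSum≡1 z rows j (ℕP.≤-pred j<1+k)) ⟩
        Cℚ ν j * 1ℚ              ≡⟨ *-comm (Cℚ ν j) 1ℚ ⟩
        1ℚ * Cℚ ν j              ∎
        where open ≡-Reasoning

    pairing⇒rows : ∀ z r → (∀ f → DegreeBelow (suc k) f → ∑ ν (λ i → weighted z i * f i) ≡ r * f ν) →
                   ∀ h → h ℕ.≤ k → row z h ≡ r * δ k h
    pairing⇒rows z r pairing = rowSum≡⇒rows z r rowSums
      where
      rowSums : ∀ j → j ℕ.≤ k → rowSum z j ≡ r
      rowSums j j≤k = *-cancelˡ-≢0 (Cℚ ν j) (Cℚ-ν-≢0 j (ℕP.≤-trans j≤k k≤ν)) (begin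
        Cℚ ν j * rowSum z j       ≡⟨ sym (moment≡rowSum z j j≤k) ⟩
        moment (weighted z) j     ≡⟨ pairing (λ s → Cℚ s j) (deg<-mono (s≤s j≤k) (deg<-Cℚ j)) ⟩
        r * Cℚ ν j                ≡⟨ *-comm r (Cℚ ν j) ⟩
        Cℚ ν j * r                ∎)
        where open ≡-Reasoning

    satisfies⇒rows : ∀ y x → SatisfiesConstraints ν d k y x → ∀ h → h ℕ.≤ k → row (net y x) h ≡ δ k h
    satisfies⇒rows y x sat h h≤k =
      subst (λ i → row (net y x) i ≡ δ k i) (FinP.toℕ-fromℕ< (s≤s h≤k)) (trans (sym (lhs≡row y x (Fin.fromℕ< (s≤s h≤k)))) (sat (Fin.fromℕ< (s≤s h≤k))))

    rows⇒lhs : ∀ y x (g : ℕ → ℚ) → (∀ h → h ℕ.≤ k → row (net y x) h ≡ g h) → ∀ h → lhs ν d k y x h ≡ g (toℕ h)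
    rows⇒lhs y x g rows h = trans (lhs≡row y x h) (rows (toℕ h) (ℕP.≤-pred (FinP.toℕ<n h)))

    objective≡ : ∀ y x → objective ν d y x ≡ ∑ ν (λ j → Cℚ ν j * extend y j) + ∑ ν (λ j → Cℚ ν j * extend x j)
    objective≡ y x = cong₂ _+_
      (Σℚ≡∑ _ _ (λ i → cong₂ _*_ (cong ℕ→ℚ (C≡choose ν (toℕ i))) (sym (extend-toℕ y i))))
      (trans (Σℚ≡∑ _ (λ j → Cℚ ν j * extend x j) (λ i → cong₂ _*_ (cong ℕ→ℚ (C≡choose ν (toℕ i))) (sym (extend-toℕ x i))))
             (∑-extend (suc d) ν _ d<ν (λ j 1+d≤j _ → trans (cong (Cℚ ν j *_) (extend-≥ x j 1+d≤j)) (*-zeroʳ (Cℚ ν j)))))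

    objective-≥ : ∀ y x → NonNeg ν d y x → ∑ ν (λ i → ∣ weighted (net y x) i ∣) ≤ objective ν d y x
    objective-≥ y x (y≥0 , x≥0) = subst (∑ ν (λ i → ∣ weighted (net y x) i ∣) ≤_)
      (sym (trans (objective≡ y x) (sym (∑-distrib-+ ν _ _)))) (∑-mono-≤ ν termwise)
      where
      termwise : ∀ j → j ℕ.< ν → ∣ weighted (net y x) j ∣ ≤ Cℚ ν j * extend y j + Cℚ ν j * extend x j
      termwise j j<ν = begin
        ∣ Cℚ ν j * (extend x j - extend y j) ∣      ≡⟨ ∣p*q∣≡∣p∣*∣q∣ (Cℚ ν j) _ ⟩
        ∣ Cℚ ν j ∣ * ∣ extend x j - extend y j ∣    ≡⟨ cong (_* ∣ extend x j - extend y j ∣) (0≤p⇒∣p∣≡p C≥0) ⟩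
        Cℚ ν j * ∣ extend x j - extend y j ∣        ≤⟨ *-monoˡ-≤-0≤ (Cℚ ν j) C≥0 (∣p-q∣≤∣p∣+∣q∣ (extend x j) (extend y j)) ⟩
        Cℚ ν j * (∣ extend x j ∣ + ∣ extend y j ∣)  ≡⟨ cong₂ (λ a b → Cℚ ν j * (a + b)) (0≤p⇒∣p∣≡p (extend-nonneg x x≥0 j)) (0≤p⇒∣p∣≡p (extend-nonneg y y≥0 j)) ⟩
        Cℚ ν j * (extend x j + extend y j)          ≡⟨ solve 3 (λ c a b → c :* (a :+ b) := c :* b :+ c :* a) refl (Cℚ ν j) (extend x j) (extend y j) ⟩
        Cℚ ν j * extend y j + Cℚ ν j * extend x j   ∎
        where
        open ≤-Reasoning
        C≥0 = <⇒≤ (Cℚ-ν-pos j (ℕP.<⇒≤ j<ν))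

    -- x and y are the positive and negative parts of u, divided by C(ν, i).
    realise : (u : ℕ → ℚ) → (∀ f → DegreeBelow (suc k) f → ∑ ν (λ i → u i * f i) ≡ f ν) →
              (∀ i → d ℕ.< i → i ℕ.< ν → u i ≡ 0ℚ) →
              Σ[ y ∈ (Fin ν → ℚ) ] Σ[ x ∈ (Fin (suc d) → ℚ) ] Feasible ν d k y x × objective ν d y x ≡ ∑ ν (λ i → ∣ u i ∣)
    realise u pairing u-high = y , x , ((y≥0 , x≥0) , satisfies) , objective≡∑∣u∣
      where
      pos neg : ℕ → ℚ
      pos j = ((∣ u j ∣ + u j) * ½) * inv (Cℚ ν j)
      neg j = ((∣ u j ∣ - u j) * ½) * inv (Cℚ ν j)
      x : Fin (suc d) → ℚ
      x = pos ∘ toℕ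
      y : Fin ν → ℚ
      y = neg ∘ toℕ
      inv-C≥0 : ∀ j → j ℕ.< ν → 0ℚ ≤ inv (Cℚ ν j)
      inv-C≥0 j j<ν = <⇒≤ (inv-pos (Cℚ ν j) (Cℚ-ν-pos j (ℕP.<⇒≤ j<ν)))
      y≥0 : ∀ i → 0ℚ ≤ y i
      y≥0 i = 0≤*0≤ (0≤*0≤ (0≤∣p∣-p (u (toℕ i))) 0≤½) (inv-C≥0 (toℕ i) (FinP.toℕ<n i))
      x≥0 : ∀ i → 0ℚ ≤ x i
      x≥0 i = 0≤*0≤ (0≤*0≤ (0≤∣p∣+p (u (toℕ i))) 0≤½) (inv-C≥0 (toℕ i) (ℕP.<-≤-trans (FinP.toℕ<n i) d<ν))
      extend-x : ∀ j → j ℕ.< ν → extend x j ≡ pos j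
      extend-x j j<ν with j ℕ.≤? d
      ... | yes j≤d = extend-tabulate pos j (s≤s j≤d)
      ... | no j≰d = begin
        extend x j                                 ≡⟨ extend-≥ x j (ℕP.≰⇒> j≰d) ⟩
        0ℚ                                         ≡⟨ sym (trans (cong (_* inv (Cℚ ν j)) (*-zeroˡ ½)) (*-zeroˡ (inv (Cℚ ν j)))) ⟩
        ((∣ 0ℚ ∣ + 0ℚ) * ½) * inv (Cℚ ν j)         ≡⟨ cong (λ w → ((∣ w ∣ + w) * ½) * inv (Cℚ ν j)) (sym (u-high j (ℕP.≰⇒> j≰d) j<ν)) ⟩
        pos j                                      ∎
        where open ≡-Reasoning
      weighted-net : ∀ j → j ℕ.< ν → weighted (net y x) j ≡ u j
      weighted-net j j<ν = begin
        Cℚ ν j * (extend x j - extend y j)   ≡⟨ cong₂ (λ a b → Cℚ ν j * (a - b)) (extend-x j j<ν) (extend-tabulate neg j j<ν) ⟩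
        Cℚ ν j * (pos j - neg j)             ≡⟨ solve 4 (λ c a u i → c :* (((a :+ u) :* con ½) :* i :- ((a :- u) :* con ½) :* i) := u :* (c :* i)) refl (Cℚ ν j) (∣ u j ∣) (u j) (inv (Cℚ ν j)) ⟩
        u j * (Cℚ ν j * inv (Cℚ ν j))        ≡⟨ cong (u j *_) (*-invʳ (Cℚ ν j) (Cℚ-ν-≢0 j (ℕP.<⇒≤ j<ν))) ⟩
        u j * 1ℚ                             ≡⟨ *-identityʳ (u j) ⟩
        u j                                  ∎
        where open ≡-Reasoning
      satisfies : SatisfiesConstraints ν d k y x
      satisfies = rows⇒lhs y x (δ k) (λ h h≤k → trans (pairing⇒rows (net y x) 1ℚ pairing′ h h≤k) (*-identityˡ (δ k h)))
        where
        pairing′ : ∀ f → DegreeBelow (suc k) f → ∑ ν (λ i → weighted (net y x) i * f i) ≡ 1ℚ * f ν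
        pairing′ f F = trans (∑-cong ν (λ i i<ν → cong (_* f i) (weighted-net i i<ν))) (trans (pairing f F) (sym (*-identityˡ (f ν))))
      objective≡∑∣u∣ : objective ν d y x ≡ ∑ ν (λ i → ∣ u i ∣)
      objective≡∑∣u∣ = trans (objective≡ y x) (trans (sym (∑-distrib-+ ν _ _)) (∑-cong ν termwise))
        where
        termwise : ∀ j → j ℕ.< ν → Cℚ ν j * extend y j + Cℚ ν j * extend x j ≡ ∣ u j ∣
        termwise j j<ν = begin
          Cℚ ν j * extend y j + Cℚ ν j * extend x j  ≡⟨ cong₂ (λ a b → Cℚ ν j * a + Cℚ ν j * b) (extend-tabulate neg j j<ν) (extend-x j j<ν) ⟩
          Cℚ ν j * neg j + Cℚ ν j * pos j            ≡⟨ solve 4 (λ c a u i → c :* (((a :- u) :* con ½) :* i) :+ c :* (((a :+ u) :* con ½) :* i) := a :* (c :* i)) refl (Cℚ ν j) (∣ u j ∣) (u j) (inv (Cℚ ν j)) ⟩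
          ∣ u j ∣ * (Cℚ ν j * inv (Cℚ ν j))          ≡⟨ cong (∣ u j ∣ *_) (*-invʳ (Cℚ ν j) (Cℚ-ν-≢0 j (ℕP.<⇒≤ j<ν))) ⟩
          ∣ u j ∣ * 1ℚ                               ≡⟨ *-identityʳ ∣ u j ∣ ⟩
          ∣ u j ∣                                    ∎
          where open ≡-Reasoning

    optimal⇒minimal : ∀ y x → IsOptimalSolution ν d k y x →
                      ∀ u → (∀ f → DegreeBelow (suc k) f → ∑ ν (λ i → u i * f i) ≡ f ν) → (∀ i → d ℕ.< i → i ℕ.< ν → u i ≡ 0ℚ) →
                      ∑ ν (λ i → ∣ weighted (net y x) i ∣) ≤ ∑ ν (λ i → ∣ u i ∣)
    optimal⇒minimal y x ((nonneg , _) , optimal) u pairing u-high =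
      let (y′ , x′ , feasible′ , objective′) = realise u pairing u-high in
      ≤-trans (objective-≥ y x nonneg) (subst (objective ν d y x ≤_) objective′ (optimal y′ x′ feasible′))

    -- A nonzero direction of the kernel carried by the nonzero coordinates of (y, x) would give a second
    -- solution of the homogeneous system supported on (Y, X), besides 0.
    base⇒no-kernel-direction : ∀ Y X y x → IsBase ν d k Y X → SupportedOn Y X y x → (ζ : ℕ → ℚ) →
      (∀ f → DegreeBelow (suc k) f → ∑ ν (λ i → weighted ζ i * f i) ≡ 0ℚ) →
      (∀ i → extend x i ≡ 0ℚ → extend y i ≡ 0ℚ → ζ i ≡ 0ℚ) →
      ∀ a → a ℕ.< ν → ζ a ≡ 0ℚ
    base⇒no-kernel-direction Y X y x base (y-supp , x-supp) ζ kernel ζ-supp a a<ν = begin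
      ζ a                         ≡⟨ sym (net°≡ζ a a<ν) ⟩
      extend x° a - extend y° a   ≡⟨ cong₂ _-_ (extend-zero x° (proj₂ unique) a) (extend-zero y° (proj₁ unique) a) ⟩
      0ℚ - 0ℚ                     ≡⟨ +-inverseʳ 0ℚ ⟩
      0ℚ                          ∎
      where
      open ≡-Reasoning
      G H : ℕ → ℚ
      G j = if nonzero (extend x j) then ζ j else 0ℚ
      H j = if nonzero (extend x j) then 0ℚ else - ζ j
      x° : Fin (suc d) → ℚ
      x° = G ∘ toℕ
      y° : Fin ν → ℚ
      y° = H ∘ toℕ
      G-at-zero : ∀ j → extend x j ≡ 0ℚ → G j ≡ 0ℚ
      G-at-zero j xj≡0 = cong (λ w → if nonzero w then ζ j else 0ℚ) xj≡0
      net°≡ζ : ∀ j → j ℕ.< ν → net y° x° j ≡ ζ j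
      net°≡ζ j j<ν = trans (cong₂ _-_ (extend-tabulate-all G (λ j 1+d≤j → G-at-zero j (extend-≥ x j 1+d≤j)) j) (extend-tabulate H j j<ν)) G-H
        where
        G-H : G j - H j ≡ ζ j
        G-H = bool-cases (nonzero (extend x j))
          (λ nz → trans (cong₂ _-_ (cong (λ b → if b then ζ j else 0ℚ) nz) (cong (λ b → if b then 0ℚ else - ζ j) nz)) (p-0≡p (ζ j)))
          (λ z → trans (cong₂ _-_ (cong (λ b → if b then ζ j else 0ℚ) z) (cong (λ b → if b then 0ℚ else - ζ j) z))
                       (solve 1 (λ z → con 0ℚ :- (:- z) := z) refl (ζ j)))
      supported° : SupportedOn Y X y° x°
      supported° = y°-supp , (λ i i∉X → G-at-zero (toℕ i) (trans (extend-toℕ x i) (x-supp i i∉X)))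
        where
        y°-supp : ∀ i → i ∉ Y → y° i ≡ 0ℚ
        y°-supp i i∉Y = bool-cases (nonzero (extend x (toℕ i)))
          (λ nz → cong (λ b → if b then 0ℚ else - ζ (toℕ i)) nz)
          (λ z → trans (cong (λ b → if b then 0ℚ else - ζ (toℕ i)) z)
                       (trans (cong -_ (ζ-supp (toℕ i) (nonzero-false _ z) (trans (extend-toℕ y i) (y-supp i i∉Y)))) -0≡0))
      solves° : ∀ h → lhs ν d k y° x° h ≡ 0ℚ
      solves° = rows⇒lhs y° x° (λ _ → 0ℚ) (λ h h≤k → trans (∑-cong ν (λ i i<ν → cong (Cℚ-offset N i h *_) (net°≡ζ i i<ν)))
                                                     (trans (pairing⇒rows ζ 0ℚ (λ f F → trans (kernel f F) (sym (*-zeroˡ (f ν)))) h h≤k)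
                                                            (*-zeroˡ (δ k h))))
      solves⁰ : ∀ h → lhs ν d k (λ _ → 0ℚ) (λ _ → 0ℚ) h ≡ 0ℚ
      solves⁰ = rows⇒lhs (λ _ → 0ℚ) (λ _ → 0ℚ) (λ _ → 0ℚ) (λ h _ → ∑-zero ν (λ i _ → begin
        Cℚ-offset N i h * (extend {suc d} (λ _ → 0ℚ) i - extend {ν} (λ _ → 0ℚ) i)
          ≡⟨ cong₂ (λ a b → Cℚ-offset N i h * (a - b)) (extend-zero {suc d} _ (λ _ → refl) i) (extend-zero {ν} _ (λ _ → refl) i) ⟩
        Cℚ-offset N i h * (0ℚ - 0ℚ)
          ≡⟨ solve 1 (λ c → c :* (con 0ℚ :- con 0ℚ) := con 0ℚ) refl (Cℚ-offset N i h) ⟩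
        0ℚ ∎))
      unique : (∀ i → y° i ≡ 0ℚ) × (∀ i → x° i ≡ 0ℚ)
      unique = proj₂ (base (λ _ → 0ℚ)) y° x° (λ _ → 0ℚ) (λ _ → 0ℚ) supported° solves° ((λ _ _ → refl) , (λ _ _ → refl)) solves⁰

module OptimalBases where

  open import Data.Nat as ℕ using (ℕ; suc; z≤n; s≤s)
  import Data.Nat.Properties as ℕP
  open import Data.Bool using (Bool; true; false)
  open import Data.Rational as ℚ using (ℚ; 0ℚ; 1ℚ; _+_; _*_; _-_; ∣_∣)
  open import Data.Rational.Properties
  open import Data.Rational.Solver using (module +-*-Solver)
  open import Data.Fin using (Fin)
  open import Data.Fin.Subset using (Subset)
  open import Data.Product using (Σ-syntax; _×_; _,_; proj₁)
  open import Data.Empty using (⊥; ⊥-elim)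
  open import Relation.Binary.PropositionalEquality
  open import Relation.Nullary using (¬_)
  open import Relation.Nullary.Decidable using (decidable-stable)
  open import Function using (id; _∘_)
  open import Defs
  open Rationals
  open BigOperators
  open Binomials
  open Polynomials
  open Interpolation
  open LinearProgram
  open +-*-Solver

  moving-right-farther : ∀ {t a c} → t ℕ.≤ a → a ℕ.< c → ℕ.∣ a - t ∣ ℕ.< ℕ.∣ c - t ∣
  moving-right-farther {t} {a} {c} t≤a a<c = subst₂ ℕ._<_
    (sym (ℕP.m≤n⇒∣n-m∣≡n∸m t≤a)) (sym (ℕP.m≤n⇒∣n-m∣≡n∸m (ℕP.≤-trans t≤a (ℕP.<⇒≤ a<c))))
    (ℕP.∸-monoˡ-< a<c t≤a)

  moving-right-ratio : ∀ {t a c ν} → t ℕ.≤ a → a ℕ.≤ c → c ℕ.≤ ν →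
                       ℕ.∣ ν - c ∣ ℕ.* ℕ.∣ t - a ∣ ℕ.≤ ℕ.∣ ν - a ∣ ℕ.* ℕ.∣ t - c ∣
  moving-right-ratio {t} {a} {c} {ν} t≤a a≤c c≤ν = subst₂ ℕ._≤_
    (sym (cong₂ ℕ._*_ (ℕP.m≤n⇒∣n-m∣≡n∸m c≤ν) (ℕP.m≤n⇒∣m-n∣≡n∸m t≤a)))
    (sym (cong₂ ℕ._*_ (ℕP.m≤n⇒∣n-m∣≡n∸m (ℕP.≤-trans a≤c c≤ν)) (ℕP.m≤n⇒∣m-n∣≡n∸m (ℕP.≤-trans t≤a a≤c))))
    (ℕP.*-mono-≤ (ℕP.∸-monoʳ-≤ ν a≤c) (ℕP.∸-monoˡ-≤ t a≤c))

  moving-to-0-farther : ∀ {b t} → 0 ℕ.< b → b ℕ.≤ t → ℕ.∣ b - t ∣ ℕ.< ℕ.∣ 0 - t ∣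
  moving-to-0-farther {b} {t} 0<b b≤t = subst (ℕ._< t) (sym (ℕP.m≤n⇒∣m-n∣≡n∸m b≤t)) (ℕP.∸-monoʳ-< 0<b b≤t)

  moving-to-0-ratio : ∀ {b t ν} → b ℕ.≤ t → t ℕ.≤ ν → ℕ.∣ ν - 0 ∣ ℕ.* ℕ.∣ t - b ∣ ℕ.≤ ℕ.∣ ν - b ∣ ℕ.* ℕ.∣ t - 0 ∣
  moving-to-0-ratio {b} {t} {ν} b≤t t≤ν = subst₂ ℕ._≤_
    (sym (trans (cong₂ ℕ._*_ (ℕP.∣-∣-identityʳ ν) (ℕP.m≤n⇒∣n-m∣≡n∸m b≤t)) (ℕP.*-distribˡ-∸ ν t b)))
    (sym (trans (cong₂ ℕ._*_ (ℕP.m≤n⇒∣n-m∣≡n∸m (ℕP.≤-trans b≤t t≤ν)) (ℕP.∣-∣-identityʳ t)) (ℕP.*-distribʳ-∸ t ν b)))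
    (ℕP.∸-monoʳ-≤ (ν ℕ.* t) (subst (b ℕ.* t ℕ.≤_) (ℕP.*-comm b ν) (ℕP.*-monoʳ-≤ b t≤ν)))

  module BasicSolution (ν d k : ℕ) (1≤k : 1 ℕ.≤ k) (k≤d : k ℕ.≤ d) (d<ν : d ℕ.< ν)
    (Y : Subset ν) (X : Subset (suc d)) (base : IsBase ν d k Y X)
    (y : Fin ν → ℚ) (x : Fin (suc d) → ℚ) (supported : SupportedOn Y X y x) (solves : SatisfiesConstraints ν d k y x) where

    open Constraints ν d k d<ν k≤d

    u : ℕ → ℚ
    u = weighted (net y x)

    pairing : ∀ f → DegreeBelow (suc k) f → ∑ ν (λ i → u i * f i) ≡ f ν
    pairing = rows⇒pairing (net y x) (satisfies⇒rows y x solves)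

    nodes : ℕ → Bool
    nodes i = nonzero (u i)

    off-nodes : ∀ i → nodes i ≡ false → u i ≡ 0ℚ
    off-nodes i = nonzero-false (u i)

    off-support⇒off-nodes : ∀ i → extend x i ≡ 0ℚ → extend y i ≡ 0ℚ → nodes i ≡ false
    off-support⇒off-nodes i xi≡0 yi≡0 = cong nonzero (trans (cong₂ (λ p q → Cℚ ν i * (p - q)) xi≡0 yi≡0) (*-zeroʳ (Cℚ ν i)))

    -- The node polynomial would have degree ≤ k, vanish on the support of u, and be positive at ν.
    at-least-k+1-nodes : suc k ℕ.≤ count ν nodes
    at-least-k+1-nodes = decidable-stable (suc k ℕ.≤? count ν nodes) λ k≮count →
      <-irrefl (sym (ν-value k≮count)) (∏-pos ν nodes (λ l → ℕ→ℚ ν - ℕ→ℚ l) (λ l l<ν _ → ν-above l<ν))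
      where
      ν-above : ∀ {l} → l ℕ.< ν → 0ℚ ℚ.< ℕ→ℚ ν - ℕ→ℚ l
      ν-above {l} l<ν = subst (0ℚ ℚ.<_) (ℕ→ℚ-∸ ν l (ℕP.<⇒≤ l<ν)) (ℕ→ℚ-mono-< (ℕP.m<n⇒0<n∸m l<ν))
      term≡0 : ∀ i → i ℕ.< ν → u i * nodePoly ν nodes i ≡ 0ℚ
      term≡0 i i<ν = bool-cases (nodes i)
        (λ node-i → trans (cong (u i *_) (nodePoly-root ν nodes i i<ν node-i)) (*-zeroʳ (u i)))
        (λ node-i → trans (cong (_* nodePoly ν nodes i) (off-nodes i node-i)) (*-zeroˡ (nodePoly ν nodes i)))
      ν-value : ¬ suc k ℕ.≤ count ν nodes → nodePoly ν nodes ν ≡ 0ℚ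
      ν-value k≮count = trans (sym (pairing (nodePoly ν nodes) (deg<-mono (s≤s (ℕP.≤-pred (ℕP.≰⇒> k≮count))) (deg<-nodePoly ν nodes))))
                              (∑-zero ν term≡0)

    -- With k + 2 nodes, some node a is interpolated by the others; the difference is a kernel direction.
    at-most-k+1-nodes : count ν nodes ℕ.≤ suc k
    at-most-k+1-nodes = decidable-stable (count ν nodes ℕ.≤? suc k) λ count≰k+1 →
      let (a , a<ν , node-a , _) = greatest ν nodes (ℕP.<-trans (s≤s z≤n) (ℕP.≰⇒> count≰k+1)) in
      kernel-direction count≰k+1 a a<ν node-a
      where
      kernel-direction : ¬ count ν nodes ℕ.≤ suc k → ∀ a → a ℕ.< ν → nodes a ≡ true → ⊥
      kernel-direction count≰k+1 a a<ν node-a = ζa≢0 (base⇒no-kernel-direction Y X y x base supported ζ kernel ζ-supported a a<ν)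
        where
        others = delete a nodes
        ω ζ : ℕ → ℚ
        ω t = δ a t - lagrange ν others a t
        ζ t = ω t * inv (Cℚ ν t)
        weighted-ζ : ∀ t → t ℕ.< ν → weighted ζ t ≡ ω t
        weighted-ζ t t<ν = trans (*-comm (Cℚ ν t) (ζ t)) (*inv*-cancel (ω t) (Cℚ ν t) (Cℚ-ν-≢0 t (ℕP.<⇒≤ t<ν)))
        kernel : ∀ f → DegreeBelow (suc k) f → ∑ ν (λ i → weighted ζ i * f i) ≡ 0ℚ
        kernel f F = begin
          ∑ ν (λ i → weighted ζ i * f i)                                      ≡⟨ ∑-cong ν (λ i i<ν → cong (_* f i) (weighted-ζ i i<ν)) ⟩
          ∑ ν (λ i → ω i * f i)                                               ≡⟨ ∑-cong ν (λ i _ → solve 3 (λ p w g → (p :- w) :* g := p :* g :- w :* g) refl (δ a i) (lagrange ν others a i) (f i)) ⟩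
          ∑ ν (λ i → δ a i * f i - lagrange ν others a i * f i)               ≡⟨ ∑-distrib-- ν (λ i → δ a i * f i) (λ i → lagrange ν others a i * f i) ⟩
          ∑ ν (λ i → δ a i * f i) - ∑ ν (λ i → lagrange ν others a i * f i)   ≡⟨ cong₂ _-_ δ-pairing (lagrange-exact ν others a f (deg<-mono k+1≤others F)) ⟩
          f a - f a                                                           ≡⟨ +-inverseʳ (f a) ⟩
          0ℚ                                                                  ∎
          where
          open ≡-Reasoning
          k+1≤others : suc k ℕ.≤ count ν others
          k+1≤others = ℕP.≤-pred (subst (suc (suc k) ℕ.≤_) (sym (count-delete ν a nodes a<ν node-a)) (ℕP.≰⇒> count≰k+1))
          δ-pairing : ∑ ν (λ i → δ a i * f i) ≡ f a
          δ-pairing = trans (∑-single ν a a<ν (λ i _ i≢a → trans (cong (_* f i) (δ-≢ i≢a)) (*-zeroˡ (f i))))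
                            (trans (cong (_* f a) (δ-refl a)) (*-identityˡ (f a)))
        ζ-supported : ∀ i → extend x i ≡ 0ℚ → extend y i ≡ 0ℚ → ζ i ≡ 0ℚ
        ζ-supported i xi≡0 yi≡0 = trans (cong (_* inv (Cℚ ν i)) ω-i≡0) (*-zeroˡ (inv (Cℚ ν i)))
          where
          node-i : nodes i ≡ false
          node-i = off-support⇒off-nodes i xi≡0 yi≡0
          i≢a : i ≢ a
          i≢a = true≢false-at {a} {i} nodes node-a node-i ∘ sym
          ω-i≡0 : ω i ≡ 0ℚ
          ω-i≡0 = begin
            δ a i - lagrange ν others a i  ≡⟨ cong₂ _-_ (δ-≢ i≢a) (lagrange-off ν others a i (delete-∉ a {i} nodes node-i)) ⟩
            0ℚ - 0ℚ                        ≡⟨ +-inverseʳ 0ℚ ⟩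
            0ℚ                             ∎
            where open ≡-Reasoning
        ζa≢0 : ζ a ≢ 0ℚ
        ζa≢0 = *-≢0 {ω a} {inv (Cℚ ν a)} (λ ωa≡0 → 1≢0 (trans (sym ω-a≡1) ωa≡0))
                    (λ inv≡0 → <-irrefl (sym inv≡0) (inv-pos (Cℚ ν a) (Cℚ-ν-pos a (ℕP.<⇒≤ a<ν))))
          where
          ω-a≡1 : ω a ≡ 1ℚ
          ω-a≡1 = begin
            δ a a - lagrange ν others a a  ≡⟨ cong₂ _-_ (δ-refl a) (lagrange-off ν others a a (delete-self a nodes)) ⟩
            1ℚ - 0ℚ                        ≡⟨ p-0≡p 1ℚ ⟩
            1ℚ                             ∎
            where open ≡-Reasoning

    count-nodes : count ν nodes ≡ suc k
    count-nodes = ℕP.≤-antisym at-most-k+1-nodes at-least-k+1-nodes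

    u≡lagrange : ∀ t → t ℕ.< ν → u t ≡ lagrange ν nodes ν t
    u≡lagrange t t<ν = bool-cases (nodes t)
      (lagrange-unique ν nodes u ν off-nodes (subst (λ m → ∀ f → DegreeBelow m f → ∑ ν (λ i → u i * f i) ≡ f ν) (sym count-nodes) pairing) t t<ν)
      (λ node-t → trans (off-nodes t node-t) (sym (lagrange-off ν nodes ν t node-t)))

    greatest-node : Σ[ a ∈ ℕ ] a ℕ.< ν × nodes a ≡ true × (∀ l → l ℕ.< ν → nodes l ≡ true → l ℕ.≤ a)
    greatest-node = greatest ν nodes (subst (0 ℕ.<_) (sym count-nodes) (s≤s z≤n))

    least-node : Σ[ b ∈ ℕ ] b ℕ.< ν × nodes b ≡ true × (∀ l → l ℕ.< ν → nodes l ≡ true → b ℕ.≤ l)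
    least-node = least ν nodes (subst (0 ℕ.<_) (sym count-nodes) (s≤s z≤n))

    -- x a ≥ x a - y a = u a / C(ν, a) > 0.
    x-pos-at-greatest : NonNeg ν d y x → ∀ a → a ℕ.< ν → nodes a ≡ true → (∀ l → l ℕ.< ν → nodes l ≡ true → l ℕ.≤ a) →
                        0ℚ ℚ.< extend x a
    x-pos-at-greatest nonneg a a<ν node-a greatest-a = <-≤-trans net-pos (begin
      extend x a - extend y a    ≤⟨ +-monoʳ-≤ (extend x a) (neg-antimono-≤ (extend-nonneg y (proj₁ nonneg) a)) ⟩
      extend x a + ℚ.- 0ℚ        ≡⟨ p-0≡p (extend x a) ⟩
      extend x a                 ∎)
      where
      open ≤-Reasoning
      C>0 = Cℚ-ν-pos a (ℕP.<⇒≤ a<ν)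
      net-pos : 0ℚ ℚ.< extend x a - extend y a
      net-pos = *-cancelˡ-<-nonNeg (Cℚ ν a) {{ℚ.nonNegative (<⇒≤ C>0)}}
        (subst₂ ℚ._<_ (sym (*-zeroʳ (Cℚ ν a))) (sym (u≡lagrange a a<ν)) (lagrange-greatest-pos ν nodes ν a ℕP.≤-refl node-a greatest-a))

    nodes≤d : NonNeg ν d y x → ∀ t → t ℕ.< ν → nodes t ≡ true → t ℕ.≤ d
    nodes≤d nonneg t t<ν node-t = decidable-stable (t ℕ.≤? d) λ t≰d →
      let (a , a<ν , node-a , a-max) = greatest-node in
      <-irrefl (sym (extend-≥ x a (ℕP.<-≤-trans (ℕP.≰⇒> t≰d) (a-max t t<ν node-t))))
               (x-pos-at-greatest nonneg a a<ν node-a a-max)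

    no-improving-exchange : IsOptimalSolution ν d k y x → (∀ t → t ℕ.< ν → nodes t ≡ true → t ℕ.≤ d) →
      ∀ e e′ → e ℕ.< ν → nodes e ≡ true → e′ ℕ.≤ d → nodes e′ ≡ false →
      (∀ t → t ℕ.< ν → delete e nodes t ≡ true → ℕ.∣ e - t ∣ ℕ.< ℕ.∣ e′ - t ∣) →
      (∀ t → t ℕ.< ν → delete e nodes t ≡ true → ℕ.∣ ν - e′ ∣ ℕ.* ℕ.∣ t - e ∣ ℕ.≤ ℕ.∣ ν - e ∣ ℕ.* ℕ.∣ t - e′ ∣) → ⊥
    no-improving-exchange optimal nodes≤d e e′ e<ν node-e e′≤d node-e′ farther ratio =
      <-irrefl refl (<-≤-trans (lagrange-exchange nonempty farther ratio) (subst (ℚ._≤ ∑ ν (λ i → ∣ u′ i ∣)) ∑∣u∣≡ minimal))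
      where
      e′<ν = ℕP.≤-<-trans e′≤d d<ν
      open Exchange ν nodes ν e e′ ℕP.≤-refl e<ν e′<ν node-e node-e′ using (S; χ′; lagrange-exchange)
      count-S : count ν S ≡ k
      count-S = ℕP.suc-injective (trans (count-delete ν e nodes e<ν node-e) count-nodes)
      nonempty : 0 ℕ.< count ν S
      nonempty = subst (0 ℕ.<_) (sym count-S) 1≤k
      count-χ′ : count ν χ′ ≡ suc k
      count-χ′ = trans (count-insert ν e′ S e′<ν (delete-∉ e {e′} nodes node-e′)) (cong suc count-S)
      u′ : ℕ → ℚ
      u′ = lagrange ν χ′ ν
      pairing′ : ∀ f → DegreeBelow (suc k) f → ∑ ν (λ i → u′ i * f i) ≡ f ν
      pairing′ f F = lagrange-exact ν χ′ ν f (subst (λ m → DegreeBelow m f) (sym count-χ′) F)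
      u′-high : ∀ i → d ℕ.< i → i ℕ.< ν → u′ i ≡ 0ℚ
      u′-high i d<i i<ν = lagrange-off ν χ′ ν i (trans (insert-other S i≢e′) (delete-∉ e {i} nodes node-i))
        where
        i≢e′ : i ≢ e′
        i≢e′ refl = ℕP.<-irrefl refl (ℕP.<-≤-trans d<i e′≤d)
        node-i : nodes i ≡ false
        node-i = bool-cases (nodes i) (λ node-i → ⊥-elim (ℕP.<-irrefl refl (ℕP.<-≤-trans d<i (nodes≤d i i<ν node-i)))) id
      minimal : ∑ ν (λ i → ∣ u i ∣) ℚ.≤ ∑ ν (λ i → ∣ u′ i ∣)
      minimal = optimal⇒minimal y x optimal u′ pairing′ u′-high
      ∑∣u∣≡ : ∑ ν (λ i → ∣ u i ∣) ≡ ∑ ν (λ i → ∣ lagrange ν nodes ν i ∣)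
      ∑∣u∣≡ = ∑-cong ν (λ i i<ν → cong ∣_∣ (u≡lagrange i i<ν))

    -- If x d = 0, trading the greatest node for d lowers the cost.
    optimal⇒x-d≢0 : NonNeg ν d y x → IsOptimalSolution ν d k y x → extend x d ≢ 0ℚ
    optimal⇒x-d≢0 nonneg optimal x-d≡0 = exchange greatest-node
      where
      exchange : Σ[ a ∈ ℕ ] a ℕ.< ν × nodes a ≡ true × (∀ l → l ℕ.< ν → nodes l ≡ true → l ℕ.≤ a) → ⊥
      exchange (a , a<ν , node-a , a-max) = no-improving-exchange optimal (nodes≤d nonneg) a d a<ν node-a ℕP.≤-refl node-d
        (λ t t<ν t∈ → moving-right-farther (a-max t t<ν (delete-⊆ {a} {t} nodes t∈)) a<d)
        (λ t t<ν t∈ → moving-right-ratio (a-max t t<ν (delete-⊆ {a} {t} nodes t∈)) (ℕP.<⇒≤ a<d) (ℕP.<⇒≤ d<ν))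
        where
        a≢d : a ≢ d
        a≢d refl = <-irrefl (sym x-d≡0) (x-pos-at-greatest nonneg a a<ν node-a a-max)
        a<d : a ℕ.< d
        a<d = ℕP.≤∧≢⇒< (nodes≤d nonneg a a<ν node-a) a≢d
        node-d : nodes d ≡ false
        node-d = bool-cases (nodes d) (λ node-d → ⊥-elim (ℕP.<-irrefl refl (ℕP.<-≤-trans a<d (a-max d d<ν node-d)))) id

    -- If x 0 = y 0 = 0, trading the least node for 0 lowers the cost.
    optimal⇒0-in-support : NonNeg ν d y x → IsOptimalSolution ν d k y x → extend x 0 ≡ 0ℚ → extend y 0 ≡ 0ℚ → ⊥
    optimal⇒0-in-support nonneg optimal x-0≡0 y-0≡0 = exchange least-node
      where
      node-0 : nodes 0 ≡ false
      node-0 = off-support⇒off-nodes 0 x-0≡0 y-0≡0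
      exchange : Σ[ b ∈ ℕ ] b ℕ.< ν × nodes b ≡ true × (∀ l → l ℕ.< ν → nodes l ≡ true → b ℕ.≤ l) → ⊥
      exchange (b , b<ν , node-b , b-min) = no-improving-exchange optimal (nodes≤d nonneg) b 0 b<ν node-b z≤n node-0
        (λ t t<ν t∈ → moving-to-0-farther 0<b (b-min t t<ν (delete-⊆ {b} {t} nodes t∈)))
        (λ t t<ν t∈ → moving-to-0-ratio (b-min t t<ν (delete-⊆ {b} {t} nodes t∈)) (ℕP.<⇒≤ t<ν))
        where
        b≢0 : b ≢ 0
        b≢0 = true≢false-at {b} {0} nodes node-b node-0
        0<b : 0 ℕ.< b
        0<b = ℕP.n≢0⇒n>0 b≢0

open import Defs
open import Data.Nat using (ℕ; suc; _≤_; _<_; z≤n)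
open import Data.Nat.Properties using (≤-<-trans)
open import Data.Fin using (Fin; toℕ; fromℕ; fromℕ<)
import Data.Fin.Properties as FinP
open import Data.Fin.Subset using (Subset; _∈_)
open import Data.Fin.Subset.Properties using (_∈?_)
open import Data.Rational using (ℚ; 0ℚ)
open import Data.Sum using (_⊎_; inj₁; inj₂)
open import Data.Product using (_×_; _,_; proj₁; proj₂)
open import Function using (_∘_)
open import Relation.Binary.PropositionalEquality using (_≡_; refl; subst; trans)
open import Relation.Nullary.Decidable using (decidable-stable; _⊎-dec_)
open LinearProgram using (extend; extend-toℕ)
open OptimalBases

proposition8 : (ν d k : ℕ) → 1 ≤ k → k ≤ d → (d<ν : d < ν) →
    (Y : Subset ν) (X : Subset (suc d)) → IsBase ν d k Y X →
    (y : Fin ν → ℚ) (x : Fin (suc d) → ℚ) → IsBasicSolution ν d k Y X y x →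
    NonNeg ν d y x → IsOptimalSolution ν d k y x →
    (fromℕ d ∈ X) × (fromℕ< (≤-<-trans z≤n d<ν) ∈ Y ⊎ Fin.zero ∈ X)
proposition8 ν d k 1≤k k≤d d<ν Y X base y x (supported , solves) nonneg optimal = d∈X , 0∈Y∪X
  where
  open BasicSolution ν d k 1≤k k≤d d<ν Y X base y x supported solves
  extend-at : ∀ {n} (v : Fin n → ℚ) j (i : Fin n) → toℕ i ≡ j → v i ≡ 0ℚ → extend v j ≡ 0ℚ
  extend-at v j i i≡j vi≡0 = subst (λ j → extend v j ≡ 0ℚ) i≡j (trans (extend-toℕ v i) vi≡0)
  d∈X : fromℕ d ∈ X
  d∈X = decidable-stable (fromℕ d ∈? X) λ d∉X →
    optimal⇒x-d≢0 nonneg optimal (extend-at x d (fromℕ d) (FinP.toℕ-fromℕ d) (proj₂ supported (fromℕ d) d∉X))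
  0<ν = ≤-<-trans z≤n d<ν
  0∈Y∪X : fromℕ< 0<ν ∈ Y ⊎ Fin.zero ∈ X
  0∈Y∪X = decidable-stable (fromℕ< 0<ν ∈? Y ⊎-dec Fin.zero ∈? X) λ 0∉Y∪X →
    optimal⇒0-in-support nonneg optimal
      (extend-at x 0 Fin.zero refl (proj₂ supported Fin.zero (0∉Y∪X ∘ inj₂)))
      (extend-at y 0 (fromℕ< 0<ν) (FinP.toℕ-fromℕ< 0<ν) (proj₁ supported (fromℕ< 0<ν) (0∉Y∪X ∘ inj₁)))
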